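{- Let $\xi_0(q)$ be the unique formal power series in $q$ with $\Theta_0(-\xi_0(q),q)=0$, where $\Theta_0(x,q)=\sum_{n\ge0}x^nq^{\binom n2}$. Then $$\xi_0(q)=\sum_{T}q^{A(T)},$$ where the sum runs over all (finite) $F_q$-enriched rooted trees $T$ and $A(T)$ is the total area of the Ferrers diagrams decorating the vertices of $T$. In particular, for each $A\ge0$ the coefficient of $q^A$ in $\xi_0(q)$ equals the (finite) number of $F_q$-enriched rooted trees of total area $A$.
   Context: A Ferrers diagram is a finite weakly decreasing sequence of positive integers $m_1\ge\dots\ge m_h$ ($h\ge1$, rows drawn bottom to top); its width is $m_1$ and its area is $\sum_i m_i$. The class $F_q$ consists of all Ferrers diagrams such that $m_n=n$ for some positive integer $n$ (the $n$-th largest row has length exactly $n$), together with one additional "empty polyomino" of width $0$ and area $0$; the size of an element is its width. An $F_q$-enriched rooted tree is a finite ordered (plane) rooted tree in which each vertex with out-degree $d$ is decorated by an element of $F_q$ of width $d$ (so leaves carry the empty polyomino); its total area is the sum of the areas of all decorations. -}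

module Defs where

open import Data.Nat as ℕ using (ℕ; zero; suc; _≥_; _≤ᵇ_; _∸_)
open import Data.Nat.Combinatorics using (_C_)
open import Data.Integer as ℤ using (ℤ; +_; -1ℤ)
open import Data.Fin using (Fin; toℕ)
open import Data.List using (List; []; _∷_; length; lookup; upTo; foldr; map)
open import Data.Nat.ListAction using (sum)
open import Data.List.Relation.Unary.All using (All)
open import Data.List.Relation.Unary.Linked using (Linked)
open import Data.List.Relation.Unary.Unique.Propositional using (Unique)
open import Data.List.Membership.Propositional using (_∈_)
open import Data.Product using (Σ; _×_)
open import Data.Sum using (_⊎_; inj₁; inj₂)
open import Data.Bool using (if_then_else_)
open import Function.Bundles using (_⇔_)
open import Relation.Binary.PropositionalEquality using (_≡_)

-- Ferrers diagrams: rows m₁ ≥ m₂ ≥ … ≥ m_h ≥ 1 (a list, first entry = bottom row)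

IsFerrers : List ℕ → Set
IsFerrers ms = Linked _≥_ ms × All (λ m → 1 ℕ.≤ m) ms

-- some n ≥ 1 with m_n = n (row index i : Fin h is the (i+1)-th row)
HasDiagonal : List ℕ → Set
HasDiagonal ms = Σ (Fin (length ms)) (λ i → lookup ms i ≡ suc (toℕ i))

FerrersFq : Set
FerrersFq = Σ (List ℕ) (λ ms → IsFerrers ms × HasDiagonal ms)

rowsOf : FerrersFq → List ℕ
rowsOf (ms Data.Product., _) = ms

width : FerrersFq → ℕ
width F with rowsOf F
... | [] = 0
... | m ∷ _ = m

ferrersArea : FerrersFq → ℕ
ferrersArea F = sum (rowsOf F)

-- elements of F_q of width (size) d: the empty polyomino (width 0)
-- or a Ferrers diagram in F_q of width d
Fq : ℕ → Set
Fq d = (d ≡ 0) ⊎ Σ FerrersFq (λ F → width F ≡ d)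

fqArea : {d : ℕ} → Fq d → ℕ
fqArea (inj₁ _) = 0
fqArea (inj₂ (F Data.Product., _)) = ferrersArea F

-- F_q-enriched ordered rooted trees: a vertex with ordered list of
-- children ts is decorated by an element of F_q of width (length ts)

data Tree : Set where
  node : (ts : List Tree) → Fq (length ts) → Tree

mutual
  treeArea : Tree → ℕ
  treeArea (node ts f) = fqArea f ℕ.+ forestArea ts

  forestArea : List Tree → ℕ
  forestArea [] = 0
  forestArea (t ∷ ts) = treeArea t ℕ.+ forestArea ts

-- there are exactly k trees of total area A (given by an explicit
-- duplicate-free list of all of them, of length k)
HasTreeCount : ℕ → ℕ → Set
HasTreeCount A k =
  Σ (List Tree) (λ L → Unique L × ((t : Tree) → (t ∈ L ⇔ (treeArea t ≡ A))) × length L ≡ k)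

FPS : Set
FPS = ℕ → ℤ

sumℤ : List ℤ → ℤ
sumℤ = foldr ℤ._+_ (+ 0)

_*ₛ_ : FPS → FPS → FPS
(f *ₛ g) n = sumℤ (map (λ k → f k ℤ.* g (n ∸ k)) (upTo (suc n)))

oneₛ : FPS
oneₛ zero = + 1
oneₛ (suc _) = + 0

_^ₛ_ : FPS → ℕ → FPS
f ^ₛ zero = oneₛ
f ^ₛ suc n = f *ₛ (f ^ₛ n)

-- Θ₀(-ξ(q), q) = Σ_{n≥0} (-1)^n ξ(q)^n q^{C(n,2)}.
-- Coefficient of q^m: only n with C(n,2) ≤ m contribute, and these all
-- satisfy n ≤ m+1, so the sum over n < m+2 is the full (finite) sum.
Theta0AtNeg : FPS → FPS
Theta0AtNeg ξ m =
  sumℤ (map (λ n → if (n C 2) ≤ᵇ m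
                     then (-1ℤ ℤ.^ n) ℤ.* (ξ ^ₛ n) (m ∸ (n C 2))
                     else + 0)
            (upTo (suc (suc m))))

IsRootOfTheta0 : FPS → Set
IsRootOfTheta0 ξ = (m : ℕ) → Theta0AtNeg ξ m ≡ + 0

module Submission where

-- Let P(x, q) count partitions by largest part and size, and F(x, q) count F_q by width and area.
-- Removing the largest part of a partition without diagonal cell and rotating the remaining rows
-- (rotate) gives a bijection onto diagonal partitions of smaller width; hence F − x satisfies the
-- recurrence characterising Θ₀(-x, q) · P(x, q), so Θ₀(-x, q) · P(x, q) = F(x, q) − x.
-- Splitting a tree at its root gives T = F(T, q) for the tree series T. Substituting x = T, the
-- right-hand side vanishes, and P(T, q) has constant term 1, so Θ₀(-T, q) = 0. Conversely every root ξ
-- satisfies ξ = F(ξ, q), and this equation determines ξ coefficient by coefficient.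
-- Series identities are proved as identities between finite sums over boxes [0, N)ᵏ weighted by
-- Kronecker deltas, with N large enough for the coefficient at hand.

open import Defs
open import Data.Nat
  using (ℕ; zero; suc; _∸_; _≤_; _<_; _≥_; z≤n; s≤s; _⊔_; _≤ᵇ_; _≡ᵇ_)
  renaming (_+_ to _+ₙ_; _*_ to _*ₙ_)
import Data.Nat.Properties as ℕP
open import Data.Nat.Combinatorics using (_C_; nCk+nC[k+1]≡[n+1]C[k+1]; nC1≡n)
open import Data.Nat.Induction using (<-rec)
open import Data.Nat.ListAction using (sum)
import Data.Nat.Tactic.RingSolver as ℕ-Solver
open import Data.Integer as ℤ using (ℤ; _+_; _*_; -_; _-_; 0ℤ; 1ℤ; -1ℤ) renaming (+_ to pos)
import Data.Integer.Properties as ℤP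
open import Data.Integer.Tactic.RingSolver using (solve-∀)
open import Data.Bool using (true; false; if_then_else_; T)
open import Data.Empty using (⊥-elim)
open import Data.Maybe using (just)
open import Data.Maybe.Properties using (just-injective)
open import Data.Fin as Fin using (Fin; toℕ)
import Data.Fin.Properties as FinP
open import Data.List
  using (List; []; _∷_; length; map; upTo; applyUpTo; lookup; concatMap; filter; head)
import Data.List.Properties as ListP
open import Data.List.Membership.Propositional using (_∈_; find; lose; mapWith∈)
open import Data.List.Membership.Propositional.Properties
  using ( ∈-map⁺; ∈-map⁻; ∈-upTo⁺; ∈-upTo⁻; ∈-concatMap⁺; ∈-concatMap⁻; ∈-filter⁺; ∈-filter⁻
        ; map-mapWith∈; mapWith∈-id)
open import Data.List.Membership.Propositional.Properties.WithK using (unique∧set⇒bag)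
open import Data.List.Relation.Binary.BagAndSetEquality using (∼bag⇒↭)
open import Data.List.Relation.Binary.Permutation.Propositional.Properties using (↭-length)
open import Data.List.Relation.Unary.Any using (here; there)
open import Data.List.Relation.Unary.All as All using ([]; _∷_)
import Data.List.Relation.Unary.All.Properties as AllP
open import Data.List.Relation.Unary.Linked as Linked using (Linked; []; [-]; _∷_)
open import Data.List.Relation.Unary.AllPairs using ([]; _∷_)
open import Data.List.Relation.Unary.Unique.Propositional using (Unique)
import Data.List.Relation.Unary.Unique.Propositional.Properties as Unique
open import Data.Product using (Σ; _×_; _,_; proj₁; proj₂)
open import Data.Sum using (inj₁; inj₂)
open import Function using (_∘_)
open import Function.Bundles using (_⇔_; mk⇔; Equivalence)
open import Relation.Binary using (tri<; tri≈; tri>)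
open import Relation.Binary.PropositionalEquality
open import Relation.Nullary using (¬_; yes; no; Dec)
open import Relation.Nullary.Decidable using (¬?)

open ≡-Reasoning

-- Finite sums

∑ : ℕ → (ℕ → ℤ) → ℤ
∑ zero    f = 0ℤ
∑ (suc n) f = f 0 + ∑ n (f ∘ suc)

syntax ∑ n (λ i → e) = ∑[ i < n ] e

sumℤ-map-upTo : ∀ n (f : ℕ → ℤ) → sumℤ (map f (upTo n)) ≡ ∑ n f
sumℤ-map-upTo n = go n (λ i → i)
  where
  go : ∀ n (g : ℕ → ℕ) (f : ℕ → ℤ) → sumℤ (map f (applyUpTo g n)) ≡ ∑ n (f ∘ g)
  go zero    g f = refl
  go (suc n) g f = cong (f (g 0) +_) (go n (g ∘ suc) f)

∑-cong< : ∀ n {f g : ℕ → ℤ} → (∀ i → i < n → f i ≡ g i) → ∑ n f ≡ ∑ n g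
∑-cong< zero    eq = refl
∑-cong< (suc n) eq = cong₂ _+_ (eq 0 (s≤s z≤n)) (∑-cong< n (λ i i<n → eq (suc i) (s≤s i<n)))

∑-cong : ∀ n {f g : ℕ → ℤ} → (∀ i → f i ≡ g i) → ∑ n f ≡ ∑ n g
∑-cong n eq = ∑-cong< n (λ i _ → eq i)

∑-zero : ∀ n {f : ℕ → ℤ} → (∀ i → i < n → f i ≡ 0ℤ) → ∑ n f ≡ 0ℤ
∑-zero zero    _  = refl
∑-zero (suc n) eq = cong₂ _+_ (eq 0 (s≤s z≤n)) (∑-zero n (λ i i<n → eq (suc i) (s≤s i<n)))

∑-distrib-+ : ∀ n (f g : ℕ → ℤ) → ∑[ i < n ] (f i + g i) ≡ ∑ n f + ∑ n g
∑-distrib-+ zero    f g = refl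
∑-distrib-+ (suc n) f g = begin
  (f 0 + g 0) + ∑[ i < n ] (f (suc i) + g (suc i))  ≡⟨ cong ((f 0 + g 0) +_) (∑-distrib-+ n (f ∘ suc) (g ∘ suc)) ⟩
  (f 0 + g 0) + (∑ n (f ∘ suc) + ∑ n (g ∘ suc))     ≡⟨ swap (f 0) (g 0) _ _ ⟩
  (f 0 + ∑ n (f ∘ suc)) + (g 0 + ∑ n (g ∘ suc))     ∎
  where
  swap : ∀ a b c d → (a + b) + (c + d) ≡ (a + c) + (b + d)
  swap = solve-∀

∑-*ˡ : ∀ n (c : ℤ) (f : ℕ → ℤ) → ∑[ i < n ] (c * f i) ≡ c * ∑ n f
∑-*ˡ zero    c f = sym (ℤP.*-zeroʳ c)
∑-*ˡ (suc n) c f = trans (cong (c * f 0 +_) (∑-*ˡ n c (f ∘ suc))) (sym (ℤP.*-distribˡ-+ c (f 0) _))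

∑-*ʳ : ∀ n (c : ℤ) (f : ℕ → ℤ) → ∑[ i < n ] (f i * c) ≡ ∑ n f * c
∑-*ʳ n c f = trans (∑-cong n (λ i → ℤP.*-comm (f i) c)) (trans (∑-*ˡ n c f) (ℤP.*-comm c (∑ n f)))

∑-neg : ∀ n (f : ℕ → ℤ) → ∑[ i < n ] (- f i) ≡ - ∑ n f
∑-neg n f = trans (∑-cong n (λ i → sym (ℤP.-1*i≡-i (f i)))) (trans (∑-*ˡ n -1ℤ f) (ℤP.-1*i≡-i (∑ n f)))

∑-comm : ∀ n m (f : ℕ → ℕ → ℤ) → ∑[ i < n ] ∑[ j < m ] f i j ≡ ∑[ j < m ] ∑[ i < n ] f i j
∑-comm zero    m f = sym (∑-zero m (λ _ _ → refl))
∑-comm (suc n) m f = trans (cong (∑ m (f 0) +_) (∑-comm n m (f ∘ suc)))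
                           (sym (∑-distrib-+ m (f 0) (λ j → ∑[ i < n ] f (suc i) j)))

∑-snoc : ∀ n (f : ℕ → ℤ) → ∑ (suc n) f ≡ ∑ n f + f n
∑-snoc zero    f = trans (ℤP.+-identityʳ (f 0)) (sym (ℤP.+-identityˡ (f 0)))
∑-snoc (suc n) f = trans (cong (f 0 +_) (∑-snoc n (f ∘ suc))) (sym (ℤP.+-assoc (f 0) _ _))

∑-split : ∀ n m (f : ℕ → ℤ) → ∑ (n +ₙ m) f ≡ ∑ n f + ∑[ i < m ] f (n +ₙ i)
∑-split zero    m f = sym (ℤP.+-identityˡ _)
∑-split (suc n) m f = trans (cong (f 0 +_) (∑-split n m (f ∘ suc))) (sym (ℤP.+-assoc (f 0) _ _))

∑-truncate : ∀ n m (f : ℕ → ℤ) → n ≤ m → (∀ i → n ≤ i → i < m → f i ≡ 0ℤ) → ∑ m f ≡ ∑ n f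
∑-truncate n m f n≤m vanish = begin
  ∑ m f                              ≡⟨ cong (λ k → ∑ k f) (sym (ℕP.m+[n∸m]≡n n≤m)) ⟩
  ∑ (n +ₙ (m ∸ n)) f                 ≡⟨ ∑-split n (m ∸ n) f ⟩
  ∑ n f + ∑[ i < m ∸ n ] f (n +ₙ i)  ≡⟨ cong (∑ n f +_) (∑-zero (m ∸ n) tail≡0) ⟩
  ∑ n f + 0ℤ                         ≡⟨ ℤP.+-identityʳ _ ⟩
  ∑ n f                              ∎
  where
  tail≡0 : ∀ i → i < m ∸ n → f (n +ₙ i) ≡ 0ℤ
  tail≡0 i i<m∸n = vanish (n +ₙ i) (ℕP.m≤m+n n i)
    (subst (n +ₙ i <_) (ℕP.m+[n∸m]≡n n≤m) (ℕP.+-monoʳ-< n i<m∸n))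

∑-single : ∀ n k (f : ℕ → ℤ) → k < n → (∀ i → i < n → i ≢ k → f i ≡ 0ℤ) → ∑ n f ≡ f k
∑-single (suc n) zero f _ others =
  trans (cong (f 0 +_) (∑-zero n (λ i i<n → others (suc i) (s≤s i<n) (λ ())))) (ℤP.+-identityʳ _)
∑-single (suc n) (suc k) f (s≤s k<n) others =
  trans (cong (_+ ∑ n (f ∘ suc)) (others 0 (s≤s z≤n) (λ ())))
    (trans (ℤP.+-identityˡ _)
      (∑-single n k (f ∘ suc) k<n (λ i i<n i≢k → others (suc i) (s≤s i<n) (i≢k ∘ ℕP.suc-injective))))

∑₂ : ℕ → (ℕ → ℕ → ℤ) → ℤ
∑₂ N f = ∑[ x < N ] ∑[ y < N ] f x y

∑₃ : ℕ → (ℕ → ℕ → ℕ → ℤ) → ℤ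
∑₃ N f = ∑[ x < N ] ∑₂ N (f x)

*-zeroˡ′ : ∀ {a} (x : ℤ) → a ≡ 0ℤ → a * x ≡ 0ℤ
*-zeroˡ′ x refl = refl

*-zeroʳ′ : ∀ {a} (x : ℤ) → a ≡ 0ℤ → x * a ≡ 0ℤ
*-zeroʳ′ x refl = ℤP.*-zeroʳ x

*-left-comm : ∀ a b x → a * (b * x) ≡ b * (a * x)
*-left-comm = solve-∀

δ : ℕ → ℕ → ℤ
δ a b = if a ≡ᵇ b then 1ℤ else 0ℤ

δ≤ : ℕ → ℕ → ℤ
δ≤ i w = if i ≤ᵇ w then 1ℤ else 0ℤ

δ-refl : ∀ a → δ a a ≡ 1ℤ
δ-refl zero    = refl
δ-refl (suc a) = δ-refl a

δ-≢ : ∀ {a b} → a ≢ b → δ a b ≡ 0ℤ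
δ-≢ {zero}  {zero}  a≢b = ⊥-elim (a≢b refl)
δ-≢ {zero}  {suc b} a≢b = refl
δ-≢ {suc a} {zero}  a≢b = refl
δ-≢ {suc a} {suc b} a≢b = δ-≢ {a} {b} (a≢b ∘ cong suc)

δ-sym : ∀ a b → δ a b ≡ δ b a
δ-sym zero    zero    = refl
δ-sym zero    (suc b) = refl
δ-sym (suc a) zero    = refl
δ-sym (suc a) (suc b) = δ-sym a b

δ-> : ∀ {x y} → y < x → δ x y ≡ 0ℤ
δ-> y<x = δ-≢ (λ x≡y → ℕP.<-irrefl (sym x≡y) y<x)

δ-+-∸ : ∀ i j n → i ≤ n → δ (i +ₙ j) n ≡ δ (n ∸ i) j
δ-+-∸ zero    j n       _         = δ-sym j n
δ-+-∸ (suc i) j (suc n) (s≤s i≤n) = δ-+-∸ i j n i≤n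

δ-+-> : ∀ i j n → n < i → δ (i +ₙ j) n ≡ 0ℤ
δ-+-> i j n n<i = δ-> (ℕP.<-≤-trans n<i (ℕP.m≤m+n i j))

δ-+-cancelʳ : ∀ x y k → δ (x +ₙ k) (y +ₙ k) ≡ δ x y
δ-+-cancelʳ x y zero    = cong₂ δ (ℕP.+-identityʳ x) (ℕP.+-identityʳ y)
δ-+-cancelʳ x y (suc k) = trans (cong₂ δ (ℕP.+-suc x k) (ℕP.+-suc y k)) (δ-+-cancelʳ x y k)

δ≤-yes : ∀ {i w} → i ≤ w → δ≤ i w ≡ 1ℤ
δ≤-yes {i} {w} i≤w with i ≤ᵇ w | ℕP.≤⇒≤ᵇ i≤w
... | true | _ = refl

δ≤-no : ∀ {i w} → ¬ i ≤ w → δ≤ i w ≡ 0ℤ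
δ≤-no {i} {w} i≰w with i ≤ᵇ w in eq
... | false = refl
... | true  = ⊥-elim (i≰w (ℕP.≤ᵇ⇒≤ i w (subst T (sym eq) _)))

∑-δ : ∀ n c (G : ℕ → ℤ) → c < n → ∑[ k < n ] (δ c k * G k) ≡ G c
∑-δ n c G c<n =
  trans (∑-single n c _ c<n (λ i _ i≢c → *-zeroˡ′ (G i) (δ-≢ (i≢c ∘ sym))))
        (trans (cong (_* G c) (δ-refl c)) (ℤP.*-identityˡ (G c)))

∑-δ-out : ∀ n c (G : ℕ → ℤ) → n ≤ c → ∑[ k < n ] (δ c k * G k) ≡ 0ℤ
∑-δ-out n c G n≤c = ∑-zero n (λ i i<n → *-zeroˡ′ (G i) (δ-> (ℕP.<-≤-trans i<n n≤c)))

∑-δ≤ : ∀ d c (Z : ℤ) → ∑[ j < d ] (δ c j * Z) ≡ δ≤ (suc c) d * Z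
∑-δ≤ d c Z with suc c ℕP.≤? d
... | yes c<d = trans (∑-δ d c (λ _ → Z) c<d) (sym (trans (cong (_* Z) (δ≤-yes c<d)) (ℤP.*-identityˡ Z)))
... | no  c≮d = trans (∑-δ-out d c (λ _ → Z) (ℕP.≮⇒≥ c≮d)) (cong (_* Z) (sym (δ≤-no c≮d)))

-- The hypothesis k ≤ F k makes the terms with c ≥ N vanish on both sides.
∑-δ-reindex : ∀ N n c (F : ℕ → ℕ) (X : ℤ) → n < N → (∀ k → k ≤ F k) →
              ∑[ k < N ] (δ (F k) n * (δ c k * X)) ≡ δ (F c) n * X
∑-δ-reindex N n c F X n<N F-infl with c ℕP.<? N
... | yes c<N = trans (∑-cong N (λ k → *-left-comm (δ (F k) n) (δ c k) X)) (∑-δ N c (λ k → δ (F k) n * X) c<N)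
... | no  c≮N = trans (∑-zero N (λ k k<N → *-zeroʳ′ (δ (F k) n) (*-zeroˡ′ X (δ-> (k<c k<N)))))
                      (sym (*-zeroˡ′ X (δ-> (ℕP.<-≤-trans n<N (ℕP.≤-trans (ℕP.≮⇒≥ c≮N) (F-infl c))))))
  where
  k<c : ∀ {k} → k < N → k < c
  k<c k<N = ℕP.<-≤-trans k<N (ℕP.≮⇒≥ c≮N)

∑-δ-+ : ∀ N i n (G : ℕ → ℤ) → n < N → ∑[ j < N ] (δ (i +ₙ j) n * G j) ≡ δ≤ i n * G (n ∸ i)
∑-δ-+ N i n G n<N with i ℕP.≤? n
... | yes i≤n = begin
  ∑[ j < N ] (δ (i +ₙ j) n * G j)  ≡⟨ ∑-cong N (λ j → cong (_* G j) (δ-+-∸ i j n i≤n)) ⟩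
  ∑[ j < N ] (δ (n ∸ i) j * G j)   ≡⟨ ∑-δ N (n ∸ i) G (ℕP.≤-<-trans (ℕP.m∸n≤m n i) n<N) ⟩
  G (n ∸ i)                        ≡⟨ sym (ℤP.*-identityˡ _) ⟩
  1ℤ * G (n ∸ i)                   ≡⟨ cong (_* G (n ∸ i)) (sym (δ≤-yes i≤n)) ⟩
  δ≤ i n * G (n ∸ i)               ∎
... | no i≰n = trans (∑-zero N (λ j _ → *-zeroˡ′ (G j) (δ-+-> i j n (ℕP.≰⇒> i≰n))))
                     (sym (*-zeroˡ′ (G (n ∸ i)) (δ≤-no i≰n)))

∑-δ≤-truncate : ∀ N n (G : ℕ → ℤ) → n < N → ∑[ i < N ] (δ≤ i n * G i) ≡ ∑[ i < suc n ] G i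
∑-δ≤-truncate N n G n<N = begin
  ∑[ i < N ] (δ≤ i n * G i)      ≡⟨ ∑-truncate (suc n) N _ n<N (λ i n<i _ → *-zeroˡ′ (G i) (δ≤-no (ℕP.<⇒≱ n<i))) ⟩
  ∑[ i < suc n ] (δ≤ i n * G i)  ≡⟨ ∑-cong< (suc n) (λ i i≤n → cong (_* G i) (δ≤-yes (ℕP.≤-pred i≤n))) ⟩
  ∑[ i < suc n ] (1ℤ * G i)      ≡⟨ ∑-cong (suc n) (λ i → ℤP.*-identityˡ (G i)) ⟩
  ∑[ i < suc n ] G i             ∎

*-∑₂ : ∀ N x (T : ℕ → ℕ → ℤ) → x * ∑₂ N T ≡ ∑₂ N (λ a b → x * T a b)
*-∑₂ N x T = trans (sym (∑-*ˡ N x (λ a → ∑ N (T a)))) (∑-cong N (λ a → sym (∑-*ˡ N x (T a))))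

*-∑₃ : ∀ N x (T : ℕ → ℕ → ℕ → ℤ) → x * ∑₃ N T ≡ ∑₃ N (λ a b c → x * T a b c)
*-∑₃ N x T = trans (sym (∑-*ˡ N x (λ a → ∑₂ N (T a)))) (∑-cong N (λ a → *-∑₂ N x (T a)))

∑₂-* : ∀ N x (T : ℕ → ℕ → ℤ) → ∑₂ N T * x ≡ ∑₂ N (λ a b → T a b * x)
∑₂-* N x T = trans (sym (∑-*ʳ N x (λ a → ∑ N (T a)))) (∑-cong N (λ a → sym (∑-*ʳ N x (T a))))

∑₃-* : ∀ N x (T : ℕ → ℕ → ℕ → ℤ) → ∑₃ N T * x ≡ ∑₃ N (λ a b c → T a b c * x)
∑₃-* N x T = trans (sym (∑-*ʳ N x (λ a → ∑₂ N (T a)))) (∑-cong N (λ a → ∑₂-* N x (T a)))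

∑₃-neg : ∀ N (T : ℕ → ℕ → ℕ → ℤ) → - ∑₃ N T ≡ ∑₃ N (λ a b c → - T a b c)
∑₃-neg N T = trans (sym (∑-neg N (λ a → ∑₂ N (T a))))
  (∑-cong N (λ a → trans (sym (∑-neg N (λ b → ∑ N (T a b)))) (∑-cong N (λ b → sym (∑-neg N (T a b))))))

∑₃-distrib-+ : ∀ N (A B : ℕ → ℕ → ℕ → ℤ) → ∑₃ N (λ x y z → A x y z + B x y z) ≡ ∑₃ N A + ∑₃ N B
∑₃-distrib-+ N A B = trans
  (∑-cong N (λ x → trans (∑-cong N (λ y → ∑-distrib-+ N (A x y) (B x y)))
                         (∑-distrib-+ N (λ y → ∑ N (A x y)) (λ y → ∑ N (B x y)))))
  (∑-distrib-+ N (λ x → ∑₂ N (A x)) (λ x → ∑₂ N (B x)))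

∑-comm₂ : ∀ N (T : ℕ → ℕ → ℕ → ℤ) → ∑[ x < N ] ∑₂ N (T x) ≡ ∑₂ N (λ p q → ∑[ x < N ] T x p q)
∑-comm₂ N T = trans (∑-comm N N _) (∑-cong N (λ p → ∑-comm N N _))

∑-comm₃ : ∀ N (T : ℕ → ℕ → ℕ → ℕ → ℤ) → ∑[ x < N ] ∑₃ N (T x) ≡ ∑₃ N (λ p q r → ∑[ x < N ] T x p q r)
∑-comm₃ N T = trans (∑-comm N N _) (∑-cong N (λ p → ∑-comm₂ N (λ x → T x p)))

∑-comm₄ : ∀ N (T : ℕ → ℕ → ℕ → ℕ → ℕ → ℤ) →
          ∑[ x < N ] ∑[ p < N ] ∑₃ N (T x p) ≡ ∑[ p < N ] ∑₃ N (λ q r u → ∑[ x < N ] T x p q r u)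
∑-comm₄ N T = trans (∑-comm N N _) (∑-cong N (λ p → ∑-comm₃ N (λ x → T x p)))

∑-comm₅ : ∀ N (T : ℕ → ℕ → ℕ → ℕ → ℕ → ℕ → ℤ) →
          ∑[ x < N ] ∑[ p < N ] ∑[ q < N ] ∑₃ N (T x p q) ≡ ∑[ p < N ] ∑[ q < N ] ∑₃ N (λ r u v → ∑[ x < N ] T x p q r u v)
∑-comm₅ N T = trans (∑-comm N N _) (∑-cong N (λ p → ∑-comm₄ N (λ x → T x p)))

∑₃-comm : ∀ N (T : ℕ → ℕ → ℕ → ℕ → ℕ → ℕ → ℤ) →
          ∑₃ N (λ x y z → ∑₃ N (T x y z)) ≡ ∑₃ N (λ p q r → ∑₃ N (λ x y z → T x y z p q r))
∑₃-comm N T = begin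
  ∑₃ N (λ x y z → ∑₃ N (T x y z))
    ≡⟨ ∑-cong N (λ x → ∑-cong N (λ y → ∑-comm₃ N (T x y))) ⟩
  ∑[ x < N ] ∑[ y < N ] ∑₃ N (λ p q r → ∑[ z < N ] T x y z p q r)
    ≡⟨ ∑-cong N (λ x → ∑-comm₃ N (λ y p q r → ∑[ z < N ] T x y z p q r)) ⟩
  ∑[ x < N ] ∑₃ N (λ p q r → ∑₂ N (λ y z → T x y z p q r))
    ≡⟨ ∑-comm₃ N (λ x p q r → ∑₂ N (λ y z → T x y z p q r)) ⟩
  ∑₃ N (λ p q r → ∑₃ N (λ x y z → T x y z p q r))  ∎

-- Formal power series

*ₛ-as-∑ : ∀ (f g : FPS) n → (f *ₛ g) n ≡ ∑[ k < suc n ] (f k * g (n ∸ k))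
*ₛ-as-∑ f g n = sumℤ-map-upTo (suc n) (λ k → f k * g (n ∸ k))

*ₛ-cong≤ : ∀ {f f′ g g′ : FPS} n → (∀ i → i ≤ n → f i ≡ f′ i) → (∀ i → i ≤ n → g i ≡ g′ i) →
           (f *ₛ g) n ≡ (f′ *ₛ g′) n
*ₛ-cong≤ {f} {f′} {g} {g′} n f≡ g≡ = begin
  (f *ₛ g) n
    ≡⟨ *ₛ-as-∑ f g n ⟩
  ∑[ k < suc n ] (f k * g (n ∸ k))
    ≡⟨ ∑-cong< (suc n) (λ k k≤n → cong₂ _*_ (f≡ k (ℕP.≤-pred k≤n)) (g≡ (n ∸ k) (ℕP.m∸n≤m n k))) ⟩
  ∑[ k < suc n ] (f′ k * g′ (n ∸ k))
    ≡⟨ sym (*ₛ-as-∑ f′ g′ n) ⟩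
  (f′ *ₛ g′) n  ∎

*ₛ-cong : ∀ {f f′ g g′ : FPS} → (∀ i → f i ≡ f′ i) → (∀ i → g i ≡ g′ i) → ∀ n → (f *ₛ g) n ≡ (f′ *ₛ g′) n
*ₛ-cong f≡ g≡ n = *ₛ-cong≤ n (λ i _ → f≡ i) (λ i _ → g≡ i)

*ₛ-as-box : ∀ (f g : FPS) n N → n < N → (f *ₛ g) n ≡ ∑₂ N (λ i j → δ (i +ₙ j) n * (f i * g j))
*ₛ-as-box f g n N n<N = sym (begin
  ∑₂ N (λ i j → δ (i +ₙ j) n * (f i * g j))  ≡⟨ ∑-cong N (λ i → ∑-δ-+ N i n (λ j → f i * g j) n<N) ⟩
  ∑[ i < N ] (δ≤ i n * (f i * g (n ∸ i)))    ≡⟨ ∑-δ≤-truncate N n (λ i → f i * g (n ∸ i)) n<N ⟩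
  ∑[ i < suc n ] (f i * g (n ∸ i))           ≡⟨ sym (*ₛ-as-∑ f g n) ⟩
  (f *ₛ g) n                                 ∎)

*ₛ-assocˡ-as-box : ∀ (f g h : FPS) n → ((f *ₛ g) *ₛ h) n ≡ ∑₃ (suc n) (λ i j l → δ (i +ₙ (j +ₙ l)) n * (f i * (g j * h l)))
*ₛ-assocˡ-as-box f g h n = begin
  ((f *ₛ g) *ₛ h) n
    ≡⟨ *ₛ-as-box (f *ₛ g) h n N (ℕP.n<1+n n) ⟩
  ∑₂ N (λ k l → δ (k +ₙ l) n * ((f *ₛ g) k * h l))
    ≡⟨ ∑-cong< N (λ k k<N → ∑-cong N (λ l → cong (λ z → δ (k +ₙ l) n * (z * h l)) (*ₛ-as-box f g k N k<N))) ⟩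
  ∑₂ N (λ k l → δ (k +ₙ l) n * (∑₂ N (λ i j → δ (i +ₙ j) k * (f i * g j)) * h l))
    ≡⟨ ∑-cong N (λ k → ∑-cong N (λ l → distribute k l)) ⟩
  ∑[ k < N ] ∑[ l < N ] ∑₂ N (λ i j → δ (k +ₙ l) n * (δ (i +ₙ j) k * X i j l))
    ≡⟨ ∑-cong N (λ k → ∑-comm₂ N (λ l i j → δ (k +ₙ l) n * (δ (i +ₙ j) k * X i j l))) ⟩
  ∑[ k < N ] ∑₃ N (λ i j l → δ (k +ₙ l) n * (δ (i +ₙ j) k * X i j l))
    ≡⟨ ∑-comm₃ N (λ k i j l → δ (k +ₙ l) n * (δ (i +ₙ j) k * X i j l)) ⟩
  ∑₃ N (λ i j l → ∑[ k < N ] (δ (k +ₙ l) n * (δ (i +ₙ j) k * X i j l)))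
    ≡⟨ ∑-cong N (λ i → ∑-cong N (λ j → ∑-cong N (λ l →
         ∑-δ-reindex N n (i +ₙ j) (_+ₙ l) (X i j l) (ℕP.n<1+n n) (λ k → ℕP.m≤m+n k l)))) ⟩
  ∑₃ N (λ i j l → δ ((i +ₙ j) +ₙ l) n * X i j l)
    ≡⟨ ∑-cong N (λ i → ∑-cong N (λ j → ∑-cong N (λ l →
         cong₂ (λ a b → δ a n * b) (ℕP.+-assoc i j l) (ℤP.*-assoc (f i) (g j) (h l))))) ⟩
  ∑₃ N (λ i j l → δ (i +ₙ (j +ₙ l)) n * (f i * (g j * h l)))  ∎
  where
  N = suc n
  X : ℕ → ℕ → ℕ → ℤ
  X i j l = (f i * g j) * h l
  distribute : ∀ k l → δ (k +ₙ l) n * (∑₂ N (λ i j → δ (i +ₙ j) k * (f i * g j)) * h l)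
                     ≡ ∑₂ N (λ i j → δ (k +ₙ l) n * (δ (i +ₙ j) k * X i j l))
  distribute k l = begin
    δ (k +ₙ l) n * (∑₂ N (λ i j → δ (i +ₙ j) k * (f i * g j)) * h l)
      ≡⟨ cong (δ (k +ₙ l) n *_) (∑₂-* N (h l) (λ i j → δ (i +ₙ j) k * (f i * g j))) ⟩
    δ (k +ₙ l) n * ∑₂ N (λ i j → (δ (i +ₙ j) k * (f i * g j)) * h l)
      ≡⟨ *-∑₂ N (δ (k +ₙ l) n) (λ i j → (δ (i +ₙ j) k * (f i * g j)) * h l) ⟩
    ∑₂ N (λ i j → δ (k +ₙ l) n * ((δ (i +ₙ j) k * (f i * g j)) * h l))
      ≡⟨ ∑-cong N (λ i → ∑-cong N (λ j → cong (δ (k +ₙ l) n *_) (ℤP.*-assoc (δ (i +ₙ j) k) (f i * g j) (h l)))) ⟩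
    ∑₂ N (λ i j → δ (k +ₙ l) n * (δ (i +ₙ j) k * X i j l))  ∎

*ₛ-assocʳ-as-box : ∀ (f g h : FPS) n → (f *ₛ (g *ₛ h)) n ≡ ∑₃ (suc n) (λ i j l → δ (i +ₙ (j +ₙ l)) n * (f i * (g j * h l)))
*ₛ-assocʳ-as-box f g h n = begin
  (f *ₛ (g *ₛ h)) n
    ≡⟨ *ₛ-as-box f (g *ₛ h) n N (ℕP.n<1+n n) ⟩
  ∑₂ N (λ i m → δ (i +ₙ m) n * (f i * (g *ₛ h) m))
    ≡⟨ ∑-cong N (λ i → ∑-cong< N (λ m m<N → cong (λ z → δ (i +ₙ m) n * (f i * z)) (*ₛ-as-box g h m N m<N))) ⟩
  ∑₂ N (λ i m → δ (i +ₙ m) n * (f i * ∑₂ N (λ j l → δ (j +ₙ l) m * (g j * h l))))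
    ≡⟨ ∑-cong N (λ i → ∑-cong N (λ m → distribute i m)) ⟩
  ∑[ i < N ] ∑[ m < N ] ∑₂ N (λ j l → δ (i +ₙ m) n * (δ (j +ₙ l) m * X i j l))
    ≡⟨ ∑-cong N (λ i → ∑-comm₂ N (λ m j l → δ (i +ₙ m) n * (δ (j +ₙ l) m * X i j l))) ⟩
  ∑₃ N (λ i j l → ∑[ m < N ] (δ (i +ₙ m) n * (δ (j +ₙ l) m * X i j l)))
    ≡⟨ ∑-cong N (λ i → ∑-cong N (λ j → ∑-cong N (λ l →
         ∑-δ-reindex N n (j +ₙ l) (i +ₙ_) (X i j l) (ℕP.n<1+n n) (λ m → ℕP.m≤n+m m i)))) ⟩
  ∑₃ N (λ i j l → δ (i +ₙ (j +ₙ l)) n * (f i * (g j * h l)))  ∎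
  where
  N = suc n
  X : ℕ → ℕ → ℕ → ℤ
  X i j l = f i * (g j * h l)
  distribute : ∀ i m → δ (i +ₙ m) n * (f i * ∑₂ N (λ j l → δ (j +ₙ l) m * (g j * h l)))
                     ≡ ∑₂ N (λ j l → δ (i +ₙ m) n * (δ (j +ₙ l) m * X i j l))
  distribute i m = begin
    δ (i +ₙ m) n * (f i * ∑₂ N (λ j l → δ (j +ₙ l) m * (g j * h l)))
      ≡⟨ cong (δ (i +ₙ m) n *_) (*-∑₂ N (f i) (λ j l → δ (j +ₙ l) m * (g j * h l))) ⟩
    δ (i +ₙ m) n * ∑₂ N (λ j l → f i * (δ (j +ₙ l) m * (g j * h l)))
      ≡⟨ *-∑₂ N (δ (i +ₙ m) n) (λ j l → f i * (δ (j +ₙ l) m * (g j * h l))) ⟩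
    ∑₂ N (λ j l → δ (i +ₙ m) n * (f i * (δ (j +ₙ l) m * (g j * h l))))
      ≡⟨ ∑-cong N (λ j → ∑-cong N (λ l → cong (δ (i +ₙ m) n *_) (*-left-comm (f i) (δ (j +ₙ l) m) (g j * h l)))) ⟩
    ∑₂ N (λ j l → δ (i +ₙ m) n * (δ (j +ₙ l) m * X i j l))  ∎

*ₛ-assoc : ∀ (f g h : FPS) n → ((f *ₛ g) *ₛ h) n ≡ (f *ₛ (g *ₛ h)) n
*ₛ-assoc f g h n = trans (*ₛ-assocˡ-as-box f g h n) (sym (*ₛ-assocʳ-as-box f g h n))

*ₛ-identityˡ : ∀ (g : FPS) n → (oneₛ *ₛ g) n ≡ g n
*ₛ-identityˡ g n = trans (*ₛ-as-∑ oneₛ g n)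
  (trans (cong₂ _+_ (ℤP.*-identityˡ (g n)) (∑-zero n (λ _ _ → refl))) (ℤP.+-identityʳ (g n)))

*ₛ-identityʳ : ∀ (g : FPS) n → (g *ₛ oneₛ) n ≡ g n
*ₛ-identityʳ g n = begin
  (g *ₛ oneₛ) n                          ≡⟨ *ₛ-as-∑ g oneₛ n ⟩
  ∑[ k < suc n ] (g k * oneₛ (n ∸ k))    ≡⟨ ∑-single (suc n) n _ (ℕP.n<1+n n) off-diagonal ⟩
  g n * oneₛ (n ∸ n)                     ≡⟨ cong (λ k → g n * oneₛ k) (ℕP.n∸n≡0 n) ⟩
  g n * 1ℤ                               ≡⟨ ℤP.*-identityʳ (g n) ⟩
  g n                                    ∎
  where
  off-diagonal : ∀ i → i < suc n → i ≢ n → g i * oneₛ (n ∸ i) ≡ 0ℤ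
  off-diagonal i i≤n i≢n with n ∸ i | ℕP.m>n⇒m∸n≢0 (ℕP.≤∧≢⇒< (ℕP.≤-pred i≤n) i≢n)
  ... | zero  | n∸i≢0 = ⊥-elim (n∸i≢0 refl)
  ... | suc _ | _     = ℤP.*-zeroʳ (g i)

^ₛ-+ : ∀ (ξ : FPS) a b n → (ξ ^ₛ (a +ₙ b)) n ≡ ((ξ ^ₛ a) *ₛ (ξ ^ₛ b)) n
^ₛ-+ ξ zero    b n = sym (*ₛ-identityˡ (ξ ^ₛ b) n)
^ₛ-+ ξ (suc a) b n = trans (*ₛ-cong {ξ} (λ _ → refl) (^ₛ-+ ξ a b) n) (sym (*ₛ-assoc ξ (ξ ^ₛ a) (ξ ^ₛ b) n))

^ₛ-cong≤ : ∀ (ξ η : FPS) d n → (∀ i → i ≤ n → ξ i ≡ η i) → (ξ ^ₛ d) n ≡ (η ^ₛ d) n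
^ₛ-cong≤ ξ η zero    n _  = refl
^ₛ-cong≤ ξ η (suc d) n ξ≡ =
  *ₛ-cong≤ n ξ≡ (λ i i≤n → ^ₛ-cong≤ ξ η d i (λ j j≤i → ξ≡ j (ℕP.≤-trans j≤i i≤n)))

*ₛ-unit-cancel : ∀ (Θ Y : FPS) → (∀ m → (Θ *ₛ Y) m ≡ 0ℤ) → Y 0 ≡ 1ℤ → ∀ m → Θ m ≡ 0ℤ
*ₛ-unit-cancel Θ Y ΘY≡0 Y₀≡1 = <-rec (λ m → Θ m ≡ 0ℤ) (λ m ih → step m (λ k → ih {k}))
  where
  step : ∀ m → (∀ k → k < m → Θ k ≡ 0ℤ) → Θ m ≡ 0ℤ
  step m ih = begin
    Θ m
      ≡⟨ sym (ℤP.*-identityʳ (Θ m)) ⟩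
    Θ m * 1ℤ
      ≡⟨ cong (Θ m *_) (trans (sym Y₀≡1) (cong Y (sym (ℕP.n∸n≡0 m)))) ⟩
    Θ m * Y (m ∸ m)
      ≡⟨ sym (ℤP.+-identityˡ _) ⟩
    0ℤ + Θ m * Y (m ∸ m)
      ≡⟨ cong (_+ Θ m * Y (m ∸ m)) (sym (∑-zero m (λ k k<m → *-zeroˡ′ (Y (m ∸ k)) (ih k k<m)))) ⟩
    ∑[ k < m ] (Θ k * Y (m ∸ k)) + Θ m * Y (m ∸ m)
      ≡⟨ sym (∑-snoc m (λ k → Θ k * Y (m ∸ k))) ⟩
    ∑[ k < suc m ] (Θ k * Y (m ∸ k))
      ≡⟨ sym (*ₛ-as-∑ Θ Y m) ⟩
    (Θ *ₛ Y) m
      ≡⟨ ΘY≡0 m ⟩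
    0ℤ  ∎

-- Series in two variables and substitution

-- u d a is the coefficient of xᵈ qᵃ.
BiSeries : Set
BiSeries = ℕ → ℕ → ℤ

-- Only then is u(ξ(q), q) defined for every ξ, including those with ξ 0 ≢ 0.
Triangular : BiSeries → Set
Triangular u = ∀ d a → a < d → u d a ≡ 0ℤ

-- u(ξ(q), q): for triangular u, no term beyond the cut-off at m contributes.
substitute : BiSeries → FPS → FPS
substitute u ξ m = ∑[ d < suc m ] ∑[ a < suc m ] (u d a * (ξ ^ₛ d) (m ∸ a))

substitute-box : ℕ → BiSeries → FPS → FPS
substitute-box N u ξ m = ∑₃ N (λ d a k → δ (a +ₙ k) m * (u d a * (ξ ^ₛ d) k))

tri : ℕ → ℕ
tri n = n C 2

tri-suc : ∀ n → tri (suc n) ≡ n +ₙ tri n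
tri-suc n = trans (sym (nCk+nC[k+1]≡[n+1]C[k+1] n 1)) (cong (_+ₙ n C 2) (nC1≡n n))

n≤1+tri : ∀ n → n ≤ suc (tri n)
n≤1+tri zero    = z≤n
n≤1+tri (suc n) = s≤s (subst (n ≤_) (sym (tri-suc n)) (ℕP.m≤m+n n (tri n)))

sgn : ℕ → ℤ
sgn n = -1ℤ ℤ.^ n

-- Θ₀(-ξ, q) and Θ₀(-x, q) · v(x, q), with all sums cut off at N.

Θ₀-box : ℕ → FPS → FPS
Θ₀-box N ξ t = ∑₂ N (λ n i → δ (tri n +ₙ i) t * (sgn n * (ξ ^ₛ n) i))

Θ₀-times : ℕ → BiSeries → BiSeries
Θ₀-times N v d a = ∑₃ N (λ n w s → δ (n +ₙ w) d * (δ (tri n +ₙ s) a * (sgn n * v w s)))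

∑₂-truncate : ∀ M N (T : ℕ → ℕ → ℤ) → M ≤ N →
              (∀ x y → M ≤ x → T x y ≡ 0ℤ) → (∀ x y → M ≤ y → T x y ≡ 0ℤ) →
              ∑₂ N T ≡ ∑₂ M T
∑₂-truncate M N T M≤N x-big y-big =
  trans (∑-truncate M N _ M≤N (λ x M≤x _ → ∑-zero N (λ y _ → x-big x y M≤x)))
        (∑-cong M (λ x → ∑-truncate M N _ M≤N (λ y M≤y _ → y-big x y M≤y)))

∑₃-truncate : ∀ M N (T : ℕ → ℕ → ℕ → ℤ) → M ≤ N → (∀ x y z → M ≤ x → T x y z ≡ 0ℤ) →
              (∀ x y z → M ≤ y → T x y z ≡ 0ℤ) → (∀ x y z → M ≤ z → T x y z ≡ 0ℤ) → ∑₃ N T ≡ ∑₃ M T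
∑₃-truncate M N T M≤N x-big y-big z-big =
  trans (∑-truncate M N _ M≤N (λ x M≤x _ → ∑-zero N (λ y _ → ∑-zero N (λ z _ → x-big x y z M≤x))))
        (∑-cong M (λ x → ∑₂-truncate M N (T x) M≤N (y-big x) (z-big x)))

δ≤-* : ∀ a b x → δ≤ a b * x ≡ (if a ≤ᵇ b then x else 0ℤ)
δ≤-* a b x with a ≤ᵇ b
... | true  = ℤP.*-identityˡ x
... | false = refl

Θ₀-box≡Theta0AtNeg : ∀ N t (ξ : FPS) → suc t < N → Θ₀-box N ξ t ≡ Theta0AtNeg ξ t
Θ₀-box≡Theta0AtNeg N t ξ t+1<N = begin
  Θ₀-box N ξ t
    ≡⟨ ∑-cong N (λ n → ∑-δ-+ N (tri n) t (λ i → sgn n * (ξ ^ₛ n) i) t<N) ⟩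
  ∑[ n < N ] (δ≤ (tri n) t * c n)
    ≡⟨ ∑-truncate M N _ t+1<N (λ n M≤n _ → *-zeroˡ′ (c n) (δ≤-no (big M≤n))) ⟩
  ∑[ n < M ] (δ≤ (tri n) t * c n)
    ≡⟨ ∑-cong M (λ n → δ≤-* (tri n) t (c n)) ⟩
  ∑[ n < M ] (if tri n ≤ᵇ t then c n else 0ℤ)
    ≡⟨ sym (sumℤ-map-upTo M (λ n → if tri n ≤ᵇ t then c n else 0ℤ)) ⟩
  Theta0AtNeg ξ t  ∎
  where
  M = suc (suc t)
  t<N = ℕP.<-trans (ℕP.n<1+n t) t+1<N
  c : ℕ → ℤ
  c n = sgn n * (ξ ^ₛ n) (t ∸ tri n)
  big : ∀ {n} → M ≤ n → ¬ tri n ≤ t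
  big M≤n tri≤t = ℕP.<-irrefl refl (ℕP.≤-trans M≤n (ℕP.≤-trans (n≤1+tri _) (s≤s tri≤t)))

substitute-box≡substitute : ∀ N m (u : BiSeries) (ξ : FPS) → Triangular u → m < N →
                            substitute-box N u ξ m ≡ substitute u ξ m
substitute-box≡substitute N m u ξ u-tri m<N = begin
  ∑₃ N (λ d a k → δ (a +ₙ k) m * (u d a * (ξ ^ₛ d) k))
    ≡⟨ ∑-cong N (λ d → ∑-cong N (λ a → ∑-δ-+ N a m (λ k → u d a * (ξ ^ₛ d) k) m<N)) ⟩
  ∑[ d < N ] ∑[ a < N ] (δ≤ a m * term d a)
    ≡⟨ ∑-cong N (λ d → ∑-δ≤-truncate N m (term d) m<N) ⟩
  ∑[ d < N ] ∑[ a < suc m ] term d a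
    ≡⟨ ∑-truncate (suc m) N (λ d → ∑[ a < suc m ] term d a) m<N
         (λ d m<d _ → ∑-zero (suc m) (λ a a≤m → *-zeroˡ′ ((ξ ^ₛ d) (m ∸ a)) (u-tri d a (ℕP.<-≤-trans a≤m m<d)))) ⟩
  substitute u ξ m  ∎
  where
  term : ℕ → ℕ → ℤ
  term d a = u d a * (ξ ^ₛ d) (m ∸ a)

X : BiSeries
X d a = δ 1 d * δ 0 a

substitute-box-X : ∀ N m (ξ : FPS) → suc m < N → substitute-box N X ξ m ≡ ξ m
substitute-box-X N m ξ m+1<N = begin
  ∑₃ N (λ d a k → δ (a +ₙ k) m * ((δ 1 d * δ 0 a) * (ξ ^ₛ d) k))
    ≡⟨ ∑-cong N (λ d → ∑-cong N (λ a → ∑-cong N (λ k → reorder (δ (a +ₙ k) m) (δ 1 d) (δ 0 a) ((ξ ^ₛ d) k)))) ⟩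
  ∑[ d < N ] ∑[ a < N ] ∑[ k < N ] (δ 1 d * (δ 0 a * (δ (a +ₙ k) m * (ξ ^ₛ d) k)))
    ≡⟨ ∑-cong N (λ d → trans (∑-cong N (λ a → ∑-*ˡ N (δ 1 d) _)) (∑-*ˡ N (δ 1 d) _)) ⟩
  ∑[ d < N ] (δ 1 d * ∑[ a < N ] ∑[ k < N ] (δ 0 a * (δ (a +ₙ k) m * (ξ ^ₛ d) k)))
    ≡⟨ ∑-δ N 1 (λ d → ∑[ a < N ] ∑[ k < N ] (δ 0 a * (δ (a +ₙ k) m * (ξ ^ₛ d) k))) (ℕP.≤-<-trans (s≤s z≤n) m+1<N) ⟩
  ∑[ a < N ] ∑[ k < N ] (δ 0 a * (δ (a +ₙ k) m * (ξ ^ₛ 1) k))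
    ≡⟨ trans (∑-cong N (λ a → ∑-*ˡ N (δ 0 a) _))
             (∑-δ N 0 (λ a → ∑[ k < N ] (δ (a +ₙ k) m * (ξ ^ₛ 1) k)) (ℕP.<-trans (s≤s z≤n) m+1<N)) ⟩
  ∑[ k < N ] (δ k m * (ξ ^ₛ 1) k)
    ≡⟨ trans (∑-cong N (λ k → cong (_* (ξ ^ₛ 1) k) (δ-sym k m))) (∑-δ N m (ξ ^ₛ 1) (ℕP.<-trans (ℕP.n<1+n m) m+1<N)) ⟩
  (ξ ^ₛ 1) m
    ≡⟨ *ₛ-identityʳ ξ m ⟩
  ξ m  ∎
  where
  reorder : ∀ I A B Z → I * ((A * B) * Z) ≡ A * (B * (I * Z))
  reorder = solve-∀

substitute-box-− : ∀ N (u w : BiSeries) ξ m →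
                   substitute-box N (λ d a → u d a - w d a) ξ m ≡ substitute-box N u ξ m - substitute-box N w ξ m
substitute-box-− N u w ξ m = begin
  substitute-box N (λ d a → u d a - w d a) ξ m
    ≡⟨ ∑-cong N (λ d → ∑-cong N (λ a → ∑-cong N (λ k → distrib (δ (a +ₙ k) m) (u d a) (w d a) ((ξ ^ₛ d) k)))) ⟩
  ∑₃ N (λ d a k → U d a k + - W d a k)
    ≡⟨ ∑₃-distrib-+ N U (λ d a k → - W d a k) ⟩
  substitute-box N u ξ m + ∑₃ N (λ d a k → - W d a k)
    ≡⟨ cong (substitute-box N u ξ m +_) (sym (∑₃-neg N W)) ⟩
  substitute-box N u ξ m - substitute-box N w ξ m  ∎
  where
  U W : ℕ → ℕ → ℕ → ℤ
  U d a k = δ (a +ₙ k) m * (u d a * (ξ ^ₛ d) k)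
  W d a k = δ (a +ₙ k) m * (w d a * (ξ ^ₛ d) k)
  distrib : ∀ I A B Z → I * ((A - B) * Z) ≡ I * (A * Z) + - (I * (B * Z))
  distrib = solve-∀

Θ₀-times-stable : ∀ N v d a → d < N → a < N → Θ₀-times N v d a ≡ Θ₀-times (suc (d ⊔ a)) v d a
Θ₀-times-stable N v d a d<N a<N = ∑₃-truncate (suc (d ⊔ a)) N _ (ℕP.⊔-lub d<N a<N)
  (λ n w s K≤n → *-zeroˡ′ _ (δ-> (ℕP.<-≤-trans (s≤s (ℕP.m≤m⊔n d a)) (ℕP.≤-trans K≤n (ℕP.m≤m+n n w)))))
  (λ n w s K≤w → *-zeroˡ′ _ (δ-> (ℕP.<-≤-trans (s≤s (ℕP.m≤m⊔n d a)) (ℕP.≤-trans K≤w (ℕP.m≤n+m w n)))))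
  (λ n w s K≤s → *-zeroʳ′ (δ (n +ₙ w) d)
                   (*-zeroˡ′ _ (δ-> (ℕP.<-≤-trans (s≤s (ℕP.m≤n⊔m d a)) (ℕP.≤-trans K≤s (ℕP.m≤n+m s (tri n)))))))

private
  Θ₀-product-box : ℕ → ℕ → FPS → BiSeries → ℤ
  Θ₀-product-box N m ξ v = ∑₃ N (λ n w s → ∑₂ N (λ i j →
    δ ((tri n +ₙ s) +ₙ (i +ₙ j)) m * ((sgn n * v w s) * ((ξ ^ₛ n) i * (ξ ^ₛ w) j))))

Θ₀-times-outside-box : ∀ N m (v : BiSeries) → Triangular v → suc (m +ₙ m) < N →
                       ∀ n w s → N ≤ n +ₙ w → ∀ x Y → δ ((tri n +ₙ s) +ₙ x) m * ((sgn n * v w s) * Y) ≡ 0ℤ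
Θ₀-times-outside-box N m v v-tri big n w s N≤n+w x Y with (tri n +ₙ s) +ₙ x ℕP.≟ m | w ℕP.≤? s
... | no  ≢m  | _   = *-zeroˡ′ ((sgn n * v w s) * Y) (δ-≢ ≢m)
... | yes _   | no w≰s = *-zeroʳ′ (δ ((tri n +ₙ s) +ₙ x) m) (*-zeroˡ′ Y (*-zeroʳ′ (sgn n) (v-tri w s (ℕP.≰⇒> w≰s))))
... | yes ≡m  | yes w≤s = ⊥-elim (ℕP.<-irrefl refl (ℕP.<-≤-trans (s≤s n+w≤) (ℕP.<-≤-trans big N≤n+w)))
  where
  tri≤m : tri n ≤ m
  tri≤m = ℕP.≤-trans (ℕP.≤-trans (ℕP.m≤m+n (tri n) s) (ℕP.m≤m+n _ x)) (ℕP.≤-reflexive ≡m)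
  s≤m : s ≤ m
  s≤m = ℕP.≤-trans (ℕP.≤-trans (ℕP.m≤n+m s (tri n)) (ℕP.m≤m+n _ x)) (ℕP.≤-reflexive ≡m)
  n+w≤ : n +ₙ w ≤ suc (m +ₙ m)
  n+w≤ = ℕP.+-mono-≤ (ℕP.≤-trans (n≤1+tri n) (s≤s tri≤m)) (ℕP.≤-trans w≤s s≤m)

substitute-box-Θ₀-times-term : ∀ N m (ξ : FPS) (v : BiSeries) n w s → m < N →
  (N ≤ n +ₙ w → ∀ x Y → δ ((tri n +ₙ s) +ₙ x) m * ((sgn n * v w s) * Y) ≡ 0ℤ) →
  ∑₃ N (λ d a k → δ (a +ₙ k) m * ((δ (n +ₙ w) d * (δ (tri n +ₙ s) a * (sgn n * v w s))) * (ξ ^ₛ d) k))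
    ≡ ∑₂ N (λ i j → δ ((tri n +ₙ s) +ₙ (i +ₙ j)) m * ((sgn n * v w s) * ((ξ ^ₛ n) i * (ξ ^ₛ w) j)))
substitute-box-Θ₀-times-term N m ξ v n w s m<N outside = begin
  ∑₃ N (λ d a k → δ (a +ₙ k) m * ((δ (n +ₙ w) d * (δ t a * c)) * (ξ ^ₛ d) k))
    ≡⟨ ∑-cong N (λ d → trans (∑-cong N (λ a → ∑-cong N (λ k →
                               reorder (δ (a +ₙ k) m) (δ (n +ₙ w) d) (δ t a) c ((ξ ^ₛ d) k))))
                            (sym (*-∑₂ N (δ (n +ₙ w) d) (λ a k → δ (a +ₙ k) m * (δ t a * (c * (ξ ^ₛ d) k)))))) ⟩
  ∑[ d < N ] (δ (n +ₙ w) d * H d)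
    ≡⟨ collapse-d ⟩
  ∑₂ N (λ i j → δ (t +ₙ (i +ₙ j)) m * (c * ((ξ ^ₛ n) i * (ξ ^ₛ w) j)))  ∎
  where
  t = tri n +ₙ s
  c = sgn n * v w s
  reorder : ∀ A B C D F → A * ((B * (C * D)) * F) ≡ B * (A * (C * (D * F)))
  reorder = solve-∀
  H : ℕ → ℤ
  H d = ∑₂ N (λ a k → δ (a +ₙ k) m * (δ t a * (c * (ξ ^ₛ d) k)))
  H-n+w : H (n +ₙ w) ≡ ∑₂ N (λ i j → δ (t +ₙ (i +ₙ j)) m * (c * ((ξ ^ₛ n) i * (ξ ^ₛ w) j)))
  H-n+w = begin
    H (n +ₙ w)
      ≡⟨ ∑-comm N N _ ⟩
    ∑[ k < N ] ∑[ a < N ] (δ (a +ₙ k) m * (δ t a * (c * (ξ ^ₛ (n +ₙ w)) k)))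
      ≡⟨ ∑-cong N (λ k → ∑-δ-reindex N m t (_+ₙ k) (c * (ξ ^ₛ (n +ₙ w)) k) m<N (λ a → ℕP.m≤m+n a k)) ⟩
    ∑[ k < N ] (δ (t +ₙ k) m * (c * (ξ ^ₛ (n +ₙ w)) k))
      ≡⟨ ∑-cong< N (λ k k<N → cong (λ z → δ (t +ₙ k) m * (c * z))
                                   (trans (^ₛ-+ ξ n w k) (*ₛ-as-box (ξ ^ₛ n) (ξ ^ₛ w) k N k<N))) ⟩
    ∑[ k < N ] (δ (t +ₙ k) m * (c * ∑₂ N (λ i j → δ (i +ₙ j) k * P i j)))
      ≡⟨ ∑-cong N (λ k → distribute k) ⟩
    ∑[ k < N ] ∑₂ N (λ i j → δ (t +ₙ k) m * (δ (i +ₙ j) k * (c * P i j)))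
      ≡⟨ ∑-comm₂ N (λ k i j → δ (t +ₙ k) m * (δ (i +ₙ j) k * (c * P i j))) ⟩
    ∑₂ N (λ i j → ∑[ k < N ] (δ (t +ₙ k) m * (δ (i +ₙ j) k * (c * P i j))))
      ≡⟨ ∑-cong N (λ i → ∑-cong N (λ j → ∑-δ-reindex N m (i +ₙ j) (t +ₙ_) (c * P i j) m<N (λ k → ℕP.m≤n+m k t))) ⟩
    ∑₂ N (λ i j → δ (t +ₙ (i +ₙ j)) m * (c * P i j))  ∎
    where
    P : ℕ → ℕ → ℤ
    P i j = (ξ ^ₛ n) i * (ξ ^ₛ w) j
    distribute : ∀ k → δ (t +ₙ k) m * (c * ∑₂ N (λ i j → δ (i +ₙ j) k * P i j))
                     ≡ ∑₂ N (λ i j → δ (t +ₙ k) m * (δ (i +ₙ j) k * (c * P i j)))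
    distribute k = begin
      δ (t +ₙ k) m * (c * ∑₂ N (λ i j → δ (i +ₙ j) k * P i j))
        ≡⟨ cong (δ (t +ₙ k) m *_) (*-∑₂ N c (λ i j → δ (i +ₙ j) k * P i j)) ⟩
      δ (t +ₙ k) m * ∑₂ N (λ i j → c * (δ (i +ₙ j) k * P i j))
        ≡⟨ *-∑₂ N (δ (t +ₙ k) m) (λ i j → c * (δ (i +ₙ j) k * P i j)) ⟩
      ∑₂ N (λ i j → δ (t +ₙ k) m * (c * (δ (i +ₙ j) k * P i j)))
        ≡⟨ ∑-cong N (λ i → ∑-cong N (λ j → cong (δ (t +ₙ k) m *_) (*-left-comm c (δ (i +ₙ j) k) (P i j)))) ⟩
      ∑₂ N (λ i j → δ (t +ₙ k) m * (δ (i +ₙ j) k * (c * P i j)))  ∎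
  collapse-d : ∑[ d < N ] (δ (n +ₙ w) d * H d) ≡ ∑₂ N (λ i j → δ (t +ₙ (i +ₙ j)) m * (c * ((ξ ^ₛ n) i * (ξ ^ₛ w) j)))
  collapse-d with n +ₙ w ℕP.<? N
  ... | yes n+w<N = trans (∑-δ N (n +ₙ w) H n+w<N) H-n+w
  ... | no  n+w≮N = trans (∑-δ-out N (n +ₙ w) H (ℕP.≮⇒≥ n+w≮N))
                          (sym (∑-zero N (λ i _ → ∑-zero N (λ j _ →
                             outside (ℕP.≮⇒≥ n+w≮N) (i +ₙ j) ((ξ ^ₛ n) i * (ξ ^ₛ w) j)))))

substitute-box-Θ₀-times-expand : ∀ N m (ξ : FPS) (v : BiSeries) → m < N →
  (∀ n w s → N ≤ n +ₙ w → ∀ x Y → δ ((tri n +ₙ s) +ₙ x) m * ((sgn n * v w s) * Y) ≡ 0ℤ) →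
  substitute-box N (Θ₀-times N v) ξ m ≡ Θ₀-product-box N m ξ v
substitute-box-Θ₀-times-expand N m ξ v m<N outside = begin
  ∑₃ N (λ d a k → δ (a +ₙ k) m * (Θ₀-times N v d a * (ξ ^ₛ d) k))
    ≡⟨ ∑-cong N (λ d → ∑-cong N (λ a → ∑-cong N (λ k →
         trans (cong (δ (a +ₙ k) m *_) (∑₃-* N ((ξ ^ₛ d) k) (λ n w s → Θ n w s d a)))
               (*-∑₃ N (δ (a +ₙ k) m) (λ n w s → Θ n w s d a * (ξ ^ₛ d) k))))) ⟩
  ∑₃ N (λ d a k → ∑₃ N (λ n w s → δ (a +ₙ k) m * (Θ n w s d a * (ξ ^ₛ d) k)))
    ≡⟨ ∑₃-comm N (λ d a k n w s → δ (a +ₙ k) m * (Θ n w s d a * (ξ ^ₛ d) k)) ⟩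
  ∑₃ N (λ n w s → ∑₃ N (λ d a k → δ (a +ₙ k) m * (Θ n w s d a * (ξ ^ₛ d) k)))
    ≡⟨ ∑-cong N (λ n → ∑-cong N (λ w → ∑-cong N (λ s → substitute-box-Θ₀-times-term N m ξ v n w s m<N (outside n w s)))) ⟩
  Θ₀-product-box N m ξ v  ∎
  where
  Θ : ℕ → ℕ → ℕ → ℕ → ℕ → ℤ
  Θ n w s d a = δ (n +ₙ w) d * (δ (tri n +ₙ s) a * (sgn n * v w s))

Θ₀-box-*ₛ-expand : ∀ N m (ξ : FPS) (v : BiSeries) → m < N →
                   (Θ₀-box N ξ *ₛ substitute-box N v ξ) m ≡ Θ₀-product-box N m ξ v
Θ₀-box-*ₛ-expand N m ξ v m<N = begin
  (Θ₀-box N ξ *ₛ substitute-box N v ξ) m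
    ≡⟨ *ₛ-as-box (Θ₀-box N ξ) (substitute-box N v ξ) m N m<N ⟩
  ∑₂ N (λ t r → δ (t +ₙ r) m * (Θ₀-box N ξ t * substitute-box N v ξ r))
    ≡⟨ ∑-cong N (λ t → ∑-cong N (λ r → distribute t r)) ⟩
  ∑[ t < N ] ∑[ r < N ] ∑[ n < N ] ∑[ i < N ] ∑₃ N (λ w s j → term t r n i w s j)
    ≡⟨ ∑-cong N (λ t → ∑-comm₅ N (λ r → term t r)) ⟩
  ∑[ t < N ] ∑[ n < N ] ∑[ i < N ] ∑₃ N (λ w s j → ∑[ r < N ] term t r n i w s j)
    ≡⟨ ∑-comm₅ N (λ t n i w s j → ∑[ r < N ] term t r n i w s j) ⟩
  ∑[ n < N ] ∑[ i < N ] ∑₃ N (λ w s j → ∑₂ N (λ t r → term t r n i w s j))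
    ≡⟨ ∑-cong N (λ n → ∑-comm₂ N (λ i w s → ∑[ j < N ] ∑₂ N (λ t r → term t r n i w s j))) ⟩
  ∑₃ N (λ n w s → ∑₂ N (λ i j → ∑₂ N (λ t r → term t r n i w s j)))
    ≡⟨ ∑-cong N (λ n → ∑-cong N (λ w → ∑-cong N (λ s → ∑-cong N (λ i → ∑-cong N (λ j → collapse-tr n i w s j))))) ⟩
  Θ₀-product-box N m ξ v  ∎
  where
  A : ℕ → ℕ → ℕ → ℤ
  A n i t = δ (tri n +ₙ i) t * (sgn n * (ξ ^ₛ n) i)
  B : ℕ → ℕ → ℕ → ℕ → ℤ
  B w s j r = δ (s +ₙ j) r * (v w s * (ξ ^ₛ w) j)
  term : ℕ → ℕ → ℕ → ℕ → ℕ → ℕ → ℕ → ℤ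
  term t r n i w s j = δ (t +ₙ r) m * (A n i t * B w s j r)
  distribute : ∀ t r → δ (t +ₙ r) m * (Θ₀-box N ξ t * substitute-box N v ξ r)
                     ≡ ∑[ n < N ] ∑[ i < N ] ∑₃ N (λ w s j → term t r n i w s j)
  distribute t r = begin
    δ (t +ₙ r) m * (∑₂ N (λ n i → A n i t) * ∑₃ N (λ w s j → B w s j r))
      ≡⟨ cong (δ (t +ₙ r) m *_) (∑₂-* N (∑₃ N (λ w s j → B w s j r)) (λ n i → A n i t)) ⟩
    δ (t +ₙ r) m * ∑₂ N (λ n i → A n i t * ∑₃ N (λ w s j → B w s j r))
      ≡⟨ *-∑₂ N (δ (t +ₙ r) m) (λ n i → A n i t * ∑₃ N (λ w s j → B w s j r)) ⟩
    ∑₂ N (λ n i → δ (t +ₙ r) m * (A n i t * ∑₃ N (λ w s j → B w s j r)))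
      ≡⟨ ∑-cong N (λ n → ∑-cong N (λ i → trans (cong (δ (t +ₙ r) m *_) (*-∑₃ N (A n i t) (λ w s j → B w s j r)))
                                               (*-∑₃ N (δ (t +ₙ r) m) (λ w s j → A n i t * B w s j r)))) ⟩
    ∑₂ N (λ n i → ∑₃ N (λ w s j → term t r n i w s j))  ∎
  collapse-tr : ∀ n i w s j → ∑₂ N (λ t r → term t r n i w s j)
                            ≡ δ ((tri n +ₙ s) +ₙ (i +ₙ j)) m * ((sgn n * v w s) * ((ξ ^ₛ n) i * (ξ ^ₛ w) j))
  collapse-tr n i w s j = begin
    ∑₂ N (λ t r → term t r n i w s j)
      ≡⟨ ∑-cong N (λ t → ∑-cong N (λ r →
           reorder (δ (t +ₙ r) m) (δ (tri n +ₙ i) t) (δ (s +ₙ j) r) (sgn n) ((ξ ^ₛ n) i) (v w s) ((ξ ^ₛ w) j))) ⟩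
    ∑₂ N (λ t r → δ (t +ₙ r) m * (δ (s +ₙ j) r * (δ (tri n +ₙ i) t * Z)))
      ≡⟨ ∑-cong N (λ t → ∑-δ-reindex N m (s +ₙ j) (t +ₙ_) (δ (tri n +ₙ i) t * Z) m<N (λ r → ℕP.m≤n+m r t)) ⟩
    ∑[ t < N ] (δ (t +ₙ (s +ₙ j)) m * (δ (tri n +ₙ i) t * Z))
      ≡⟨ ∑-δ-reindex N m (tri n +ₙ i) (_+ₙ (s +ₙ j)) Z m<N (λ t → ℕP.m≤m+n t (s +ₙ j)) ⟩
    δ ((tri n +ₙ i) +ₙ (s +ₙ j)) m * Z
      ≡⟨ cong (λ e → δ e m * Z) (interchange (tri n) i s j) ⟩
    δ ((tri n +ₙ s) +ₙ (i +ₙ j)) m * Z  ∎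
    where
    Z = (sgn n * v w s) * ((ξ ^ₛ n) i * (ξ ^ₛ w) j)
    reorder : ∀ I P Q sg En vv Ew → I * ((P * (sg * En)) * (Q * (vv * Ew))) ≡ I * (Q * (P * ((sg * vv) * (En * Ew))))
    reorder = solve-∀
    interchange : ∀ a i s j → (a +ₙ i) +ₙ (s +ₙ j) ≡ (a +ₙ s) +ₙ (i +ₙ j)
    interchange = ℕ-Solver.solve-∀

substitute-box-Θ₀-times : ∀ N m (ξ : FPS) (v : BiSeries) → Triangular v → suc (m +ₙ m) < N →
  substitute-box N (Θ₀-times N v) ξ m ≡ (Θ₀-box N ξ *ₛ substitute-box N v ξ) m
substitute-box-Θ₀-times N m ξ v v-tri big =
  trans (substitute-box-Θ₀-times-expand N m ξ v m<N (Θ₀-times-outside-box N m v v-tri big))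
        (sym (Θ₀-box-*ₛ-expand N m ξ v m<N))
  where
  m<N : m < N
  m<N = ℕP.<-trans (s≤s (ℕP.m≤m+n m m)) big

-- Counting with duplicate-free lists

#_ : ∀ {A : Set} → List A → ℤ
# xs = pos (length xs)

private
  variable
    A B : Set

∈-concatMap⁺′ : ∀ {f : A → List B} {xs a b} → a ∈ xs → b ∈ f a → b ∈ concatMap f xs
∈-concatMap⁺′ {f = f} a∈xs b∈fa = ∈-concatMap⁺ f (lose a∈xs b∈fa)

∈-concatMap⁻′ : ∀ (f : A → List B) xs {b} → b ∈ concatMap f xs → Σ A (λ a → a ∈ xs × b ∈ f a)
∈-concatMap⁻′ f xs b∈ = find (∈-concatMap⁻ f {xs} b∈)

concatMap-unique : ∀ (f : A → List B) xs → Unique xs → (∀ a → a ∈ xs → Unique (f a)) →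
                   (∀ a a′ b → a ∈ xs → a′ ∈ xs → b ∈ f a → b ∈ f a′ → a ≡ a′) → Unique (concatMap f xs)
concatMap-unique f []       _            _        _        = []
concatMap-unique f (x ∷ xs) (x∉xs ∷ xs!) f-unique disjoint =
  Unique.++⁺ (f-unique x (here refl))
    (concatMap-unique f xs xs! (λ a a∈ → f-unique a (there a∈)) (λ a a′ b a∈ a′∈ → disjoint a a′ b (there a∈) (there a′∈)))
    (λ (b∈fx , b∈rest) → let (a , a∈xs , b∈fa) = ∈-concatMap⁻′ f xs b∈rest in
                          All.lookup x∉xs a∈xs (disjoint x a _ (here refl) (there a∈xs) b∈fx b∈fa))

#-concatMap-upTo : ∀ n (f : ℕ → List B) → # concatMap f (upTo n) ≡ ∑[ j < n ] # f j
#-concatMap-upTo n f = go n (λ i → i)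
  where
  go : ∀ n (g : ℕ → ℕ) → # concatMap f (applyUpTo g n) ≡ ∑[ j < n ] # f (g j)
  go zero    g = refl
  go (suc n) g = trans (cong pos (ListP.length-++ (f (g 0)))) (cong (# f (g 0) +_) (go n (g ∘ suc)))

length-concatMap-const : ∀ (f : A → List B) xs c → (∀ x → x ∈ xs → length (f x) ≡ c) →
                         length (concatMap f xs) ≡ length xs *ₙ c
length-concatMap-const f []       c _     = refl
length-concatMap-const f (x ∷ xs) c len≡c =
  trans (ListP.length-++ (f x)) (cong₂ _+ₙ_ (len≡c x (here refl)) (length-concatMap-const f xs c (λ y y∈ → len≡c y (there y∈))))

map-unique-on : ∀ (f : A → B) xs → Unique xs → (∀ x y → x ∈ xs → y ∈ xs → f x ≡ f y → x ≡ y) → Unique (map f xs)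
map-unique-on f []       []           _   = []
map-unique-on f (x ∷ xs) (x∉xs ∷ xs!) inj =
  AllP.map⁺ (All.tabulate (λ {y} y∈ fx≡fy → All.lookup x∉xs y∈ (inj x y (here refl) (there y∈) fx≡fy)))
    ∷ map-unique-on f xs xs! (λ a b a∈ b∈ → inj a b (there a∈) (there b∈))

unique-length : ∀ {xs ys : List A} → Unique xs → Unique ys → (∀ {x} → x ∈ xs ⇔ x ∈ ys) → length xs ≡ length ys
unique-length xs! ys! same = ↭-length (∼bag⇒↭ (unique∧set⇒bag xs! ys! same))

length-filter-split : ∀ {P : A → Set} (P? : ∀ x → Dec (P x)) xs →
                      length (filter P? xs) +ₙ length (filter (¬? ∘ P?) xs) ≡ length xs
length-filter-split P? []       = refl
length-filter-split P? (x ∷ xs) with P? x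
... | yes _ = cong suc (length-filter-split P? xs)
... | no  _ = trans (ℕP.+-suc _ _) (cong suc (length-filter-split P? xs))

-- Partitions

largestPart : List ℕ → ℕ
largestPart []      = 0
largestPart (m ∷ _) = m

data Partition : ℕ → ℕ → List ℕ → Set where
  nil  : Partition 0 0 []
  cons : ∀ {d j a ms} → j ≤ suc d → Partition j a ms → Partition (suc d) (suc d +ₙ a) (suc d ∷ ms)

Partition-largestPart : ∀ {d a ms} → Partition d a ms → largestPart ms ≡ d
Partition-largestPart nil        = refl
Partition-largestPart (cons _ _) = refl

Partition-largest≤size : ∀ {d a ms} → Partition d a ms → d ≤ a
Partition-largest≤size nil            = z≤n
Partition-largest≤size (cons {d} _ _) = ℕP.m≤m+n (suc d) _

Partition-sum : ∀ {d a ms} → Partition d a ms → sum ms ≡ a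
Partition-sum nil            = refl
Partition-sum (cons {d} _ π) = cong (suc d +ₙ_) (Partition-sum π)

Partition-resize : ∀ {d a a′ ms} → a ≡ a′ → Partition d a ms → Partition d a′ ms
Partition-resize refl π = π

Partition-largest-unique : ∀ {d d′ a a′ ms} → Partition d a ms → Partition d′ a′ ms → d ≡ d′
Partition-largest-unique π π′ = trans (sym (Partition-largestPart π)) (Partition-largestPart π′)

-- The fuel only has to exceed the size; see partitions-fuel-irrelevant.
partitions : (fuel d a : ℕ) → List (List ℕ)
partitions fuel     zero    zero    = [] ∷ []
partitions fuel     zero    (suc a) = []
partitions zero     (suc d) a       = []
partitions (suc fuel) (suc d) a     =
  if suc d ≤ᵇ a then map (suc d ∷_) (concatMap (λ j → partitions fuel j (a ∸ suc d)) (upTo (suc (suc d)))) else []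

partitions-sound : ∀ fuel d a {ms} → ms ∈ partitions fuel d a → Partition d a ms
partitions-sound fuel     zero    zero    (here refl) = nil
partitions-sound (suc fuel) (suc d) a ms∈ with suc d ≤ᵇ a in d<a
... | true  with ∈-map⁻ (suc d ∷_) ms∈
... | ms′ , ms′∈ , refl with ∈-concatMap⁻′ (λ j → partitions fuel j (a ∸ suc d)) (upTo (suc (suc d))) ms′∈
... | j , j∈ , ms′∈′ =
  Partition-resize (ℕP.m+[n∸m]≡n (ℕP.≤ᵇ⇒≤ (suc d) a (subst T (sym d<a) _)))
    (cons (ℕP.≤-pred (∈-upTo⁻ j∈)) (partitions-sound fuel j (a ∸ suc d) ms′∈′))

partitions-complete : ∀ fuel {d a ms} → Partition d a ms → a ≤ fuel → ms ∈ partitions fuel d a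
partitions-complete fuel       nil                          _         = here refl
partitions-complete (suc fuel) (cons {d} {j} {a} {ms} j≤ π) (s≤s a≤)
  with suc d ≤ᵇ (suc d +ₙ a) | ℕP.≤⇒≤ᵇ (ℕP.m≤m+n (suc d) a)
... | true | _ = ∈-map⁺ (suc d ∷_) (∈-concatMap⁺′ {f = λ j → partitions fuel j ((suc d +ₙ a) ∸ suc d)} (∈-upTo⁺ (s≤s j≤))
                   (subst (λ b → ms ∈ partitions fuel j b) (sym (ℕP.m+n∸m≡n (suc d) a))
                     (partitions-complete fuel π (ℕP.≤-trans (ℕP.m≤n+m a d) a≤))))

partitions-unique : ∀ fuel d a → Unique (partitions fuel d a)
partitions-unique fuel       zero    zero    = [] ∷ []
partitions-unique fuel       zero    (suc a) = []
partitions-unique zero       (suc d) a       = []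
partitions-unique (suc fuel) (suc d) a with suc d ≤ᵇ a
... | false = []
... | true  = Unique.map⁺ ListP.∷-injectiveʳ
  (concatMap-unique (λ j → partitions fuel j (a ∸ suc d)) (upTo (suc (suc d))) (Unique.upTo⁺ _)
    (λ j _ → partitions-unique fuel j (a ∸ suc d))
    (λ j j′ ms _ _ ms∈ ms∈′ → Partition-largest-unique (partitions-sound fuel j _ ms∈) (partitions-sound fuel j′ _ ms∈′)))

partitions-fuel-irrelevant : ∀ fuel fuel′ d a → a ≤ fuel → a ≤ fuel′ →
                             length (partitions fuel d a) ≡ length (partitions fuel′ d a)
partitions-fuel-irrelevant fuel fuel′ d a a≤ a≤′ =
  unique-length (partitions-unique fuel d a) (partitions-unique fuel′ d a)
    (mk⇔ (λ ms∈ → partitions-complete fuel′ (partitions-sound fuel d a ms∈) a≤′)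
         (λ ms∈ → partitions-complete fuel (partitions-sound fuel′ d a ms∈) a≤))

P : BiSeries
P d a = # partitions a d a

P-triangular : Triangular P
P-triangular w s s<w with partitions s w s | partitions-sound s w s
... | []     | _     = refl
... | _ ∷ _  | sound = ⊥-elim (ℕP.<⇒≱ s<w (Partition-largest≤size (sound (here refl))))

P-remove-largest : ∀ w s → w ≤ s → P w s ≡ ∑[ i < suc w ] P i (s ∸ w)
P-remove-largest zero    s       _    = sym (ℤP.+-identityʳ (P 0 s))
P-remove-largest (suc d) (suc s) d<s with suc d ≤ᵇ suc s | ℕP.≤⇒≤ᵇ d<s
... | true | _ = begin
  # map (suc d ∷_) (concatMap (λ j → partitions s j (s ∸ d)) (upTo (suc (suc d))))
    ≡⟨ cong pos (ListP.length-map (suc d ∷_) (concatMap (λ j → partitions s j (s ∸ d)) (upTo (suc (suc d))))) ⟩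
  # concatMap (λ j → partitions s j (s ∸ d)) (upTo (suc (suc d)))
    ≡⟨ #-concatMap-upTo (suc (suc d)) (λ j → partitions s j (s ∸ d)) ⟩
  ∑[ j < suc (suc d) ] # partitions s j (s ∸ d)
    ≡⟨ ∑-cong (suc (suc d)) (λ j → cong pos (partitions-fuel-irrelevant s (s ∸ d) j _ (ℕP.m∸n≤m s d) ℕP.≤-refl)) ⟩
  ∑[ j < suc (suc d) ] P j (s ∸ d)  ∎

P-box : ∀ N w s → s < N → P w s ≡ ∑₂ N (λ i t → δ (w +ₙ t) s * (δ≤ i w * P i t))
P-box N w s s<N = sym (begin
  ∑₂ N (λ i t → δ (w +ₙ t) s * (δ≤ i w * P i t))     ≡⟨ ∑-cong N (λ i → ∑-δ-+ N w s (λ t → δ≤ i w * P i t) s<N) ⟩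
  ∑[ i < N ] (δ≤ w s * (δ≤ i w * P i (s ∸ w)))       ≡⟨ ∑-*ˡ N (δ≤ w s) (λ i → δ≤ i w * P i (s ∸ w)) ⟩
  δ≤ w s * ∑[ i < N ] (δ≤ i w * P i (s ∸ w))         ≡⟨ by-cases ⟩
  P w s                                              ∎)
  where
  by-cases : δ≤ w s * ∑[ i < N ] (δ≤ i w * P i (s ∸ w)) ≡ P w s
  by-cases with w ℕP.≤? s
  ... | yes w≤s = begin
    δ≤ w s * ∑[ i < N ] (δ≤ i w * P i (s ∸ w))  ≡⟨ cong (_* ∑[ i < N ] (δ≤ i w * P i (s ∸ w))) (δ≤-yes w≤s) ⟩
    1ℤ * ∑[ i < N ] (δ≤ i w * P i (s ∸ w))      ≡⟨ ℤP.*-identityˡ _ ⟩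
    ∑[ i < N ] (δ≤ i w * P i (s ∸ w))           ≡⟨ ∑-δ≤-truncate N w (λ i → P i (s ∸ w)) (ℕP.≤-<-trans w≤s s<N) ⟩
    ∑[ i < suc w ] P i (s ∸ w)                  ≡⟨ sym (P-remove-largest w s w≤s) ⟩
    P w s                                       ∎
  ... | no  w≰s = trans (*-zeroˡ′ _ (δ≤-no w≰s)) (sym (P-triangular w s (ℕP.≰⇒> w≰s)))

-- The product Θ₀(-x, q) · P(x, q)

-- The coefficientwise form of r(x, q) = P(x, q) − x r(xq, q) / (1 − xq), which comes from
-- Θ₀(-x, q) = 1 − x Θ₀(-xq, q) and P(x, q) = P(xq, q) / (1 − xq).
ThetaRecurrence : BiSeries → Set
ThetaRecurrence r = (∀ d a → d ≤ suc a → r d a ≡ P d a - ∑[ j < d ] r j (suc a ∸ d))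
                  × (∀ d a → suc a < d → r d a ≡ 0ℤ)

ThetaRecurrence-unique : ∀ {r r′} → ThetaRecurrence r → ThetaRecurrence r′ → ∀ d a → r d a ≡ r′ d a
ThetaRecurrence-unique {r} {r′} (r-rec , r-zero) (r′-rec , r′-zero) =
  <-rec (λ d → ∀ a → r d a ≡ r′ d a) (λ d ih → step d (λ j → ih {j}))
  where
  step : ∀ d → (∀ j → j < d → ∀ a → r j a ≡ r′ j a) → ∀ a → r d a ≡ r′ d a
  step d ih a with d ℕP.≤? suc a
  ... | yes d≤ = trans (r-rec d a d≤)
                  (trans (cong (λ z → P d a - z) (∑-cong< d (λ j j<d → ih j j<d (suc a ∸ d)))) (sym (r′-rec d a d≤)))
  ... | no  d≰ = trans (r-zero d a (ℕP.≰⇒> d≰)) (sym (r′-zero d a (ℕP.≰⇒> d≰)))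

Θ₀-times-head : ∀ N (v : BiSeries) d a → d < N → a < N →
                ∑₂ N (λ w s → δ (0 +ₙ w) d * (δ (tri 0 +ₙ s) a * (sgn 0 * v w s))) ≡ v d a
Θ₀-times-head N v d a d<N a<N = begin
  ∑₂ N (λ w s → δ w d * (δ s a * (1ℤ * v w s)))
    ≡⟨ ∑-cong N (λ w → trans (∑-*ˡ N (δ w d) _) (cong (δ w d *_) (sum-s w))) ⟩
  ∑[ w < N ] (δ w d * (1ℤ * v w a))
    ≡⟨ trans (∑-cong N (λ w → cong (_* (1ℤ * v w a)) (δ-sym w d))) (∑-δ N d (λ w → 1ℤ * v w a) d<N) ⟩
  1ℤ * v d a
    ≡⟨ ℤP.*-identityˡ (v d a) ⟩
  v d a  ∎
  where
  sum-s : ∀ w → ∑[ s < N ] (δ s a * (1ℤ * v w s)) ≡ 1ℤ * v w a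
  sum-s w = trans (∑-cong N (λ s → cong (_* (1ℤ * v w s)) (δ-sym s a))) (∑-δ N a (λ s → 1ℤ * v w s) a<N)

neg-∑-Θ₀-times : ∀ N (v : BiSeries) d b →
  - ∑[ j < d ] Θ₀-times N v j b ≡ ∑₃ N (λ n i t → δ≤ (suc (n +ₙ i)) d * (δ (tri n +ₙ t) b * (sgn (suc n) * v i t)))
neg-∑-Θ₀-times N v d b = begin
  - ∑[ j < d ] ∑₃ N (λ n i t → δ (n +ₙ i) j * Z n i t)
    ≡⟨ cong -_ (trans (∑-comm d N _) (∑-cong N (λ n → trans (∑-comm d N _) (∑-cong N (λ i → ∑-comm d N _))))) ⟩
  - ∑₃ N (λ n i t → ∑[ j < d ] (δ (n +ₙ i) j * Z n i t))
    ≡⟨ cong -_ (∑-cong N (λ n → ∑-cong N (λ i → ∑-cong N (λ t → ∑-δ≤ d (n +ₙ i) (Z n i t))))) ⟩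
  - ∑₃ N (λ n i t → δ≤ (suc (n +ₙ i)) d * Z n i t)
    ≡⟨ ∑₃-neg N (λ n i t → δ≤ (suc (n +ₙ i)) d * Z n i t) ⟩
  ∑₃ N (λ n i t → - (δ≤ (suc (n +ₙ i)) d * Z n i t))
    ≡⟨ ∑-cong N (λ n → ∑-cong N (λ i → ∑-cong N (λ t →
         neg-inside (δ≤ (suc (n +ₙ i)) d) (δ (tri n +ₙ t) b) (sgn n) (v i t)))) ⟩
  ∑₃ N (λ n i t → δ≤ (suc (n +ₙ i)) d * (δ (tri n +ₙ t) b * (sgn (suc n) * v i t)))  ∎
  where
  Z : ℕ → ℕ → ℕ → ℤ
  Z n i t = δ (tri n +ₙ t) b * (sgn n * v i t)
  neg-inside : ∀ L I s V → - (L * (I * (s * V))) ≡ L * (I * ((-1ℤ * s) * V))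
  neg-inside = solve-∀

-- The q-shift hidden in tri (suc n) = n + tri n.
Θ₀-shift-term : ∀ N d a n i t (Z : ℤ) → d < N → d ≤ suc a →
  ∑[ w < N ] (δ (suc n +ₙ w) d * (δ (tri (suc n) +ₙ (w +ₙ t)) a * (δ≤ i w * Z)))
    ≡ δ≤ (suc (n +ₙ i)) d * (δ (tri n +ₙ t) (suc a ∸ d) * Z)
Θ₀-shift-term N d a n i t Z d<N d≤a+1 with suc n ℕP.≤? d
Θ₀-shift-term N (suc k) a n i t Z d<N (s≤s k≤a) | yes (s≤s n≤k) = begin
  ∑[ w < N ] (δ (suc n +ₙ w) (suc k) * (δ (tri (suc n) +ₙ (w +ₙ t)) a * (δ≤ i w * Z)))
    ≡⟨ ∑-cong N (λ w → cong (_* (δ (tri (suc n) +ₙ (w +ₙ t)) a * (δ≤ i w * Z))) (δ-+-∸ (suc n) w (suc k) (s≤s n≤k))) ⟩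
  ∑[ w < N ] (δ e w * (δ (tri (suc n) +ₙ (w +ₙ t)) a * (δ≤ i w * Z)))
    ≡⟨ ∑-δ N e (λ w → δ (tri (suc n) +ₙ (w +ₙ t)) a * (δ≤ i w * Z))
           (ℕP.≤-<-trans (ℕP.m∸n≤m k n) (ℕP.<-trans (ℕP.n<1+n k) d<N)) ⟩
  δ (tri (suc n) +ₙ (e +ₙ t)) a * (δ≤ i e * Z)
    ≡⟨ cong₂ (λ x y → x * (y * Z)) δ-shift δ≤-shift ⟩
  δ (tri n +ₙ t) (a ∸ k) * (δ≤ (suc (n +ₙ i)) (suc k) * Z)
    ≡⟨ *-left-comm (δ (tri n +ₙ t) (a ∸ k)) (δ≤ (suc (n +ₙ i)) (suc k)) Z ⟩
  δ≤ (suc (n +ₙ i)) (suc k) * (δ (tri n +ₙ t) (a ∸ k) * Z)  ∎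
  where
  e = k ∸ n
  n+e≡k : n +ₙ e ≡ k
  n+e≡k = ℕP.m+[n∸m]≡n n≤k
  regroup : ∀ n tn e t → (n +ₙ tn) +ₙ (e +ₙ t) ≡ (tn +ₙ t) +ₙ (n +ₙ e)
  regroup = ℕ-Solver.solve-∀
  δ-shift : δ (tri (suc n) +ₙ (e +ₙ t)) a ≡ δ (tri n +ₙ t) (a ∸ k)
  δ-shift = begin
    δ (tri (suc n) +ₙ (e +ₙ t)) a
      ≡⟨ cong₂ δ (trans (cong (_+ₙ (e +ₙ t)) (tri-suc n)) (trans (regroup n (tri n) e t) (cong ((tri n +ₙ t) +ₙ_) n+e≡k)))
                 (sym (ℕP.m∸n+n≡m k≤a)) ⟩
    δ ((tri n +ₙ t) +ₙ k) ((a ∸ k) +ₙ k)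
      ≡⟨ δ-+-cancelʳ (tri n +ₙ t) (a ∸ k) k ⟩
    δ (tri n +ₙ t) (a ∸ k)  ∎
  δ≤-shift : δ≤ i e ≡ δ≤ (suc (n +ₙ i)) (suc k)
  δ≤-shift with i ℕP.≤? e
  ... | yes i≤e = trans (δ≤-yes i≤e)
                        (sym (δ≤-yes {suc (n +ₙ i)} {suc k} (s≤s (subst (n +ₙ i ≤_) n+e≡k (ℕP.+-monoʳ-≤ n i≤e)))))
  ... | no  i≰e = trans (δ≤-no i≰e) (sym (δ≤-no {suc (n +ₙ i)} {suc k}
                        (λ { (s≤s n+i≤k) → i≰e (subst (_≤ e) (ℕP.m+n∸m≡n n i) (ℕP.∸-monoˡ-≤ n n+i≤k)) })))
Θ₀-shift-term N d a n i t Z d<N d≤a+1 | no n≮d =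
  trans (∑-zero N (λ w _ → *-zeroˡ′ _ (δ-+-> (suc n) w d (ℕP.≰⇒> n≮d))))
        (sym (*-zeroˡ′ _ (δ≤-no (λ n+i<d → n≮d (ℕP.≤-trans (s≤s (ℕP.m≤m+n n i)) n+i<d)))))

Θ₀-times-P-tail : ∀ N d a n → d < N → a < N → d ≤ suc a →
  ∑₂ N (λ w s → δ (suc n +ₙ w) d * (δ (tri (suc n) +ₙ s) a * (sgn (suc n) * P w s)))
    ≡ ∑₂ N (λ i t → δ≤ (suc (n +ₙ i)) d * (δ (tri n +ₙ t) (suc a ∸ d) * (sgn (suc n) * P i t)))
Θ₀-times-P-tail N d a n d<N a<N d≤a+1 = begin
  ∑₂ N (λ w s → δ (suc n +ₙ w) d * (δ (tri (suc n) +ₙ s) a * (σ * P w s)))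
    ≡⟨ ∑-cong N (λ w → ∑-cong< N (λ s s<N → expand-P w s s<N)) ⟩
  ∑[ w < N ] ∑[ s < N ] ∑₂ N (λ i t → U w s i t)
    ≡⟨ ∑-comm₃ N (λ w s i t → U w s i t) ⟩
  ∑[ s < N ] ∑₂ N (λ i t → ∑[ w < N ] U w s i t)
    ≡⟨ ∑-comm₂ N (λ s i t → ∑[ w < N ] U w s i t) ⟩
  ∑₂ N (λ i t → ∑[ s < N ] ∑[ w < N ] U w s i t)
    ≡⟨ ∑-cong N (λ i → ∑-cong N (λ t → ∑-comm N N (λ s w → U w s i t))) ⟩
  ∑₂ N (λ i t → ∑[ w < N ] ∑[ s < N ] U w s i t)
    ≡⟨ ∑-cong N (λ i → ∑-cong N (λ t → ∑-cong N (λ w →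
         ∑-δ-reindex N a (w +ₙ t) (tri (suc n) +ₙ_) (δ (suc n +ₙ w) d * (δ≤ i w * (σ * P i t))) a<N
                     (λ s → ℕP.m≤n+m s (tri (suc n)))))) ⟩
  ∑₂ N (λ i t → ∑[ w < N ] (δ (tri (suc n) +ₙ (w +ₙ t)) a * (δ (suc n +ₙ w) d * (δ≤ i w * (σ * P i t)))))
    ≡⟨ ∑-cong N (λ i → ∑-cong N (λ t →
         trans (∑-cong N (λ w → *-left-comm (δ (tri (suc n) +ₙ (w +ₙ t)) a) (δ (suc n +ₙ w) d) (δ≤ i w * (σ * P i t))))
               (Θ₀-shift-term N d a n i t (σ * P i t) d<N d≤a+1))) ⟩
  ∑₂ N (λ i t → δ≤ (suc (n +ₙ i)) d * (δ (tri n +ₙ t) (suc a ∸ d) * (σ * P i t)))  ∎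
  where
  σ = sgn (suc n)
  U : ℕ → ℕ → ℕ → ℕ → ℤ
  U w s i t = δ (tri (suc n) +ₙ s) a * (δ (w +ₙ t) s * (δ (suc n +ₙ w) d * (δ≤ i w * (σ * P i t))))
  reorder : ∀ A B C I L Q → A * (B * (C * (I * (L * Q)))) ≡ B * (I * (A * (L * (C * Q))))
  reorder = solve-∀
  expand-P : ∀ w s → s < N → δ (suc n +ₙ w) d * (δ (tri (suc n) +ₙ s) a * (σ * P w s)) ≡ ∑₂ N (λ i t → U w s i t)
  expand-P w s s<N = begin
    δ (suc n +ₙ w) d * (δ (tri (suc n) +ₙ s) a * (σ * P w s))
      ≡⟨ cong (λ z → δ (suc n +ₙ w) d * (δ (tri (suc n) +ₙ s) a * (σ * z))) (P-box N w s s<N) ⟩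
    δ (suc n +ₙ w) d * (δ (tri (suc n) +ₙ s) a * (σ * ∑₂ N (λ i t → δ (w +ₙ t) s * (δ≤ i w * P i t))))
      ≡⟨ cong (λ z → δ (suc n +ₙ w) d * (δ (tri (suc n) +ₙ s) a * z))
              (*-∑₂ N σ (λ i t → δ (w +ₙ t) s * (δ≤ i w * P i t))) ⟩
    δ (suc n +ₙ w) d * (δ (tri (suc n) +ₙ s) a * ∑₂ N (λ i t → σ * (δ (w +ₙ t) s * (δ≤ i w * P i t))))
      ≡⟨ cong (δ (suc n +ₙ w) d *_) (*-∑₂ N (δ (tri (suc n) +ₙ s) a) (λ i t → σ * (δ (w +ₙ t) s * (δ≤ i w * P i t)))) ⟩
    δ (suc n +ₙ w) d * ∑₂ N (λ i t → δ (tri (suc n) +ₙ s) a * (σ * (δ (w +ₙ t) s * (δ≤ i w * P i t))))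
      ≡⟨ *-∑₂ N (δ (suc n +ₙ w) d) (λ i t → δ (tri (suc n) +ₙ s) a * (σ * (δ (w +ₙ t) s * (δ≤ i w * P i t)))) ⟩
    ∑₂ N (λ i t → δ (suc n +ₙ w) d * (δ (tri (suc n) +ₙ s) a * (σ * (δ (w +ₙ t) s * (δ≤ i w * P i t)))))
      ≡⟨ ∑-cong N (λ i → ∑-cong N (λ t →
           reorder (δ (suc n +ₙ w) d) (δ (tri (suc n) +ₙ s) a) σ (δ (w +ₙ t) s) (δ≤ i w) (P i t))) ⟩
    ∑₂ N (λ i t → U w s i t)  ∎

Θ₀-times-P-recurrence : ∀ N d a → d < suc N → a < suc N → d ≤ suc a →
  Θ₀-times (suc N) P d a ≡ P d a - ∑[ j < d ] Θ₀-times (suc N) P j (suc a ∸ d)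
Θ₀-times-P-recurrence N d a d<N a<N d≤a+1 = begin
  Θ₀-times (suc N) P d a
    ≡⟨⟩
  term 0 + ∑[ n < N ] term (suc n)
    ≡⟨ cong₂ _+_ (Θ₀-times-head (suc N) P d a d<N a<N) (sym (∑-truncate N (suc N) (term ∘ suc) (ℕP.n≤1+n N) last≡0)) ⟩
  P d a + ∑[ n < suc N ] term (suc n)
    ≡⟨ cong (P d a +_) (∑-cong (suc N) (λ n → Θ₀-times-P-tail (suc N) d a n d<N a<N d≤a+1)) ⟩
  P d a + ∑₃ (suc N) (λ n i t → δ≤ (suc (n +ₙ i)) d * (δ (tri n +ₙ t) (suc a ∸ d) * (sgn (suc n) * P i t)))
    ≡⟨ cong (P d a +_) (sym (neg-∑-Θ₀-times (suc N) P d (suc a ∸ d))) ⟩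
  P d a - ∑[ j < d ] Θ₀-times (suc N) P j (suc a ∸ d)  ∎
  where
  term : ℕ → ℤ
  term n = ∑₂ (suc N) (λ w s → δ (n +ₙ w) d * (δ (tri n +ₙ s) a * (sgn n * P w s)))
  last≡0 : ∀ i → N ≤ i → i < suc N → term (suc i) ≡ 0ℤ
  last≡0 i N≤i _ = ∑-zero (suc N) (λ w _ → ∑-zero (suc N) (λ s _ →
    *-zeroˡ′ (δ (tri (suc i) +ₙ s) a * (sgn (suc i) * P w s)) (δ-+-> (suc i) w d (ℕP.<-≤-trans d<N (s≤s N≤i)))))

Θ₀P : BiSeries
Θ₀P d a = Θ₀-times (suc (d ⊔ a)) P d a

Θ₀P-recurrence : ThetaRecurrence Θ₀P
Θ₀P-recurrence = recurrence , vanishing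
  where
  recurrence : ∀ d a → d ≤ suc a → Θ₀P d a ≡ P d a - ∑[ j < d ] Θ₀P j (suc a ∸ d)
  recurrence d a d≤a+1 = begin
    Θ₀P d a
      ≡⟨ sym (Θ₀-times-stable (suc (d +ₙ a)) P d a d<M a<M) ⟩
    Θ₀-times (suc (d +ₙ a)) P d a
      ≡⟨ Θ₀-times-P-recurrence (d +ₙ a) d a d<M a<M d≤a+1 ⟩
    P d a - ∑[ j < d ] Θ₀-times (suc (d +ₙ a)) P j (suc a ∸ d)
      ≡⟨ cong (λ z → P d a - z) (∑-cong< d (λ j j<d → Θ₀-times-stable (suc (d +ₙ a)) P j (suc a ∸ d)
                                                  (ℕP.<-≤-trans j<d (ℕP.m≤n⇒m≤1+n (ℕP.m≤m+n d a))) (rest<M j<d))) ⟩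
    P d a - ∑[ j < d ] Θ₀P j (suc a ∸ d)  ∎
    where
    d<M = s≤s (ℕP.m≤m+n d a)
    a<M = s≤s (ℕP.m≤n+m a d)
    rest<M : ∀ {j} → j < d → suc a ∸ d < suc (d +ₙ a)
    rest<M j<d = s≤s (ℕP.≤-trans (ℕP.∸-monoʳ-≤ (suc a) (ℕP.≤-trans (s≤s z≤n) j<d)) (ℕP.m≤n+m a d))
  vanishing : ∀ d a → suc a < d → Θ₀P d a ≡ 0ℤ
  vanishing d a a+1<d = ∑-zero K (λ n _ → ∑-zero K (λ w _ → ∑-zero K (λ s _ → term≡0 n w s)))
    where
    K = suc (d ⊔ a)
    term≡0 : ∀ n w s → δ (n +ₙ w) d * (δ (tri n +ₙ s) a * (sgn n * P w s)) ≡ 0ℤ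
    term≡0 n w s with n +ₙ w ℕP.≟ d | tri n +ₙ s ℕP.≟ a | w ℕP.≤? s
    ... | no ≢d  | _      | _       = *-zeroˡ′ _ (δ-≢ ≢d)
    ... | yes _  | no ≢a  | _       = *-zeroʳ′ (δ (n +ₙ w) d) (*-zeroˡ′ _ (δ-≢ ≢a))
    ... | yes _  | yes _  | no w≰s  =
      *-zeroʳ′ (δ (n +ₙ w) d) (*-zeroʳ′ (δ (tri n +ₙ s) a) (*-zeroʳ′ (sgn n) (P-triangular w s (ℕP.≰⇒> w≰s))))
    ... | yes ≡d | yes ≡a | yes w≤s = ⊥-elim (ℕP.<-irrefl refl (ℕP.<-≤-trans a+1<d (subst (_≤ suc a) ≡d
                                          (ℕP.≤-trans (ℕP.+-mono-≤ (n≤1+tri n) w≤s) (s≤s (ℕP.≤-reflexive ≡a))))))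

-- Partitions with and without a diagonal cell

-- OnDiagonal k ms: the row of index i (counted from 0) has length k + i for some i.
data OnDiagonal : ℕ → List ℕ → Set where
  here  : ∀ {k ms} → OnDiagonal k (k ∷ ms)
  there : ∀ {k m ms} → OnDiagonal (suc k) ms → OnDiagonal k (m ∷ ms)

onDiagonal? : ∀ k ms → Dec (OnDiagonal k ms)
onDiagonal? k []       = no (λ ())
onDiagonal? k (m ∷ ms) with m ℕP.≟ k | onDiagonal? (suc k) ms
... | yes refl | _      = yes here
... | no  _    | yes on = yes (there on)
... | no  m≢k  | no off = no (λ { here → m≢k refl ; (there on) → off on })

Diagonal : List ℕ → Set
Diagonal = OnDiagonal 1

Diagonal? : ∀ ms → Dec (Diagonal ms)
Diagonal? = onDiagonal? 1

OnDiagonal⇒lookup : ∀ {k ms} → OnDiagonal k ms → Σ (Fin (length ms)) (λ i → lookup ms i ≡ toℕ i +ₙ k)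
OnDiagonal⇒lookup here       = Fin.zero , refl
OnDiagonal⇒lookup (there on) with OnDiagonal⇒lookup on
... | i , eq = Fin.suc i , trans eq (ℕP.+-suc (toℕ i) _)

lookup⇒OnDiagonal : ∀ {k} ms (i : Fin (length ms)) → lookup ms i ≡ toℕ i +ₙ k → OnDiagonal k ms
lookup⇒OnDiagonal (m ∷ ms) Fin.zero    refl = here
lookup⇒OnDiagonal (m ∷ ms) (Fin.suc i) eq   = there (lookup⇒OnDiagonal ms i (trans eq (sym (ℕP.+-suc (toℕ i) _))))

HasDiagonal⇔Diagonal : ∀ ms → HasDiagonal ms ⇔ Diagonal ms
HasDiagonal⇔Diagonal ms = mk⇔ (λ (i , eq) → lookup⇒OnDiagonal ms i (trans eq (ℕP.+-comm 1 (toℕ i))))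
                              (λ on → let (i , eq) = OnDiagonal⇒lookup on in i , trans eq (ℕP.+-comm (toℕ i) 1))

Partition-¬OnDiagonal : ∀ {j a ms} k → Partition j a ms → j < k → ¬ OnDiagonal k ms
Partition-¬OnDiagonal k (cons j₂≤ π) d<k here       = ℕP.<-irrefl refl d<k
Partition-¬OnDiagonal k (cons j₂≤ π) d<k (there on) =
  Partition-¬OnDiagonal (suc k) π (ℕP.<-trans (ℕP.≤-<-trans j₂≤ d<k) (ℕP.n<1+n k)) on

-- Shortening by one each leading row i that exceeds k + i + 1, and inserting a row of length k + i at
-- the first row where this fails, creates a diagonal cell; unrotate undoes it.
rotate : ℕ → List ℕ → List ℕ
rotate k []       = k ∷ []
rotate k (t ∷ ts) with suc k ℕP.<? t
... | yes _ = (t ∸ 1) ∷ rotate (suc k) ts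
... | no  _ = k ∷ t ∷ ts

unrotate : ℕ → List ℕ → List ℕ
unrotate k []       = []
unrotate k (m ∷ ms) with m ℕP.≟ k
... | yes _ = ms
... | no  _ = suc m ∷ unrotate (suc k) ms

rotate-OnDiagonal : ∀ k t → OnDiagonal k (rotate k t)
rotate-OnDiagonal k []       = here
rotate-OnDiagonal k (t ∷ ts) with suc k ℕP.<? t
... | yes _ = there (rotate-OnDiagonal (suc k) ts)
... | no  _ = here

unrotate-rotate : ∀ k t → unrotate k (rotate k t) ≡ t
unrotate-rotate k [] with k ℕP.≟ k
... | yes _   = refl
... | no  k≢k = ⊥-elim (k≢k refl)
unrotate-rotate k (suc t ∷ ts) with suc k ℕP.<? suc t
... | yes (s≤s k<t) with t ℕP.≟ k
...   | yes t≡k = ⊥-elim (ℕP.<-irrefl (sym t≡k) k<t)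
...   | no  _   = cong (suc t ∷_) (unrotate-rotate (suc k) ts)
unrotate-rotate k (suc t ∷ ts) | no _ with k ℕP.≟ k
...   | yes _   = refl
...   | no  k≢k = ⊥-elim (k≢k refl)
unrotate-rotate k (zero ∷ ts) with k ℕP.≟ k
... | yes _   = refl
... | no  k≢k = ⊥-elim (k≢k refl)

rotate-Partition : ∀ {j b t} k → Partition j b t → ¬ OnDiagonal (suc (suc k)) t →
                   Σ ℕ (λ j′ → Partition j′ (b +ₙ suc k) (rotate (suc k) t) × j′ ≤ suc k ⊔ (j ∸ 1))
rotate-Partition k nil _ = suc k , Partition-resize (ℕP.+-identityʳ (suc k)) (cons z≤n nil) , ℕP.m≤m⊔n (suc k) 0
rotate-Partition k (cons {d} {j₂} {a′} j₂≤ π) off with suc (suc k) ℕP.<? suc d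
... | yes (s≤s (s≤s k+1≤d′)) =
  let (j″ , π″ , j″≤) = rotate-Partition (suc k) π (off ∘ there) in
  suc _ , Partition-resize (reassoc _ a′ k) (cons (ℕP.≤-trans j″≤ (ℕP.⊔-lub (s≤s k+1≤d′) (ℕP.∸-monoˡ-≤ 1 j₂≤))) π″)
  , ℕP.m≤n⊔m (suc k) _
  where
  reassoc : ∀ d a k → suc d +ₙ (a +ₙ suc (suc k)) ≡ (suc (suc d) +ₙ a) +ₙ suc k
  reassoc = ℕ-Solver.solve-∀
... | no  d≮k+1 = suc k , Partition-resize (ℕP.+-comm (suc k) (suc d +ₙ a′)) (cons d<k (cons j₂≤ π)) , ℕP.m≤m⊔n (suc k) d
  where
  d<k : suc d ≤ suc k
  d<k = ℕP.≤∧≢⇒< (ℕP.≮⇒≥ (d≮k+1 ∘ s≤s)) (λ { refl → off here })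

unrotate-Partition : ∀ {j b y} k → Partition j b y → OnDiagonal k y →
  Σ ℕ (λ j′ → Partition j′ (b ∸ k) (unrotate k y) × j′ ≤ suc j) × ¬ OnDiagonal (suc k) (unrotate k y) × k ≤ b
unrotate-Partition k (cons {d} {j₂} {a′} {ms} j₂≤ π) on with suc d ℕP.≟ k
... | yes refl = (j₂ , Partition-resize (sym (ℕP.m+n∸m≡n (suc d) a′)) π , ℕP.m≤n⇒m≤1+n j₂≤)
               , Partition-¬OnDiagonal (suc (suc d)) π (s≤s j₂≤) , ℕP.m≤m+n (suc d) a′
unrotate-Partition k (cons {d} {j₂} {a′} j₂≤ π) here       | no d+1≢k = ⊥-elim (d+1≢k refl)
unrotate-Partition k (cons {d} {j₂} {a′} j₂≤ π) (there on) | no d+1≢k with unrotate-Partition (suc k) π on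
... | (j″ , π″ , j″≤) , off , k+1≤a′ =
  (suc (suc d) , Partition-resize size (cons (ℕP.≤-trans j″≤ (s≤s j₂≤)) π″) , ℕP.≤-refl)
  , (λ { here → d+1≢k refl ; (there on′) → off on′ })
  , ℕP.≤-trans (ℕP.n≤1+n k) (ℕP.≤-trans k+1≤a′ (ℕP.m≤n+m a′ (suc d)))
  where
  shift : ∀ d k e → suc (suc d) +ₙ e ≡ (suc d +ₙ (suc k +ₙ e)) ∸ k
  shift d k e = sym (trans (cong (_∸ k) (reassoc d k e)) (ℕP.m+n∸n≡m (suc (suc d) +ₙ e) k))
    where
    reassoc : ∀ d k e → suc d +ₙ (suc k +ₙ e) ≡ (suc (suc d) +ₙ e) +ₙ k
    reassoc = ℕ-Solver.solve-∀
  size : suc (suc d) +ₙ (a′ ∸ suc k) ≡ (suc d +ₙ a′) ∸ k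
  size = trans (shift d k (a′ ∸ suc k)) (cong (λ z → (suc d +ₙ z) ∸ k) (ℕP.m+[n∸m]≡n k+1≤a′))

rotate-unrotate : ∀ {j b y} k → Partition j b y → OnDiagonal k y → rotate k (unrotate k y) ≡ y
rotate-unrotate k (cons {d} {j₂} {a′} {ms} j₂≤ π) on with suc d ℕP.≟ k
... | yes refl = rotate-below π j₂≤
  where
  rotate-below : ∀ {j a ms} → Partition j a ms → j ≤ suc d → rotate (suc d) ms ≡ suc d ∷ ms
  rotate-below nil _ = refl
  rotate-below (cons {d₂} _ _) d₂<d+1 with suc (suc d) ℕP.<? suc d₂
  ... | yes d+1<d₂ = ⊥-elim (ℕP.<-asym (ℕP.<-≤-trans d+1<d₂ d₂<d+1) (ℕP.n<1+n (suc d)))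
  ... | no  _      = refl
rotate-unrotate k (cons j₂≤ π) here | no d+1≢k = ⊥-elim (d+1≢k refl)
rotate-unrotate {y = suc d ∷ ms} k (cons j₂≤ π) (there on) | no d+1≢k with suc k ℕP.<? suc (suc d)
... | yes _   = cong (suc d ∷_) (rotate-unrotate (suc k) π on)
... | no  k≰d = ⊥-elim (Partition-¬OnDiagonal k (cons j₂≤ π) d+1<k (there on))
  where
  d+1<k : suc d < k
  d+1<k = ℕP.≤∧≢⇒< (ℕP.≮⇒≥ (k≰d ∘ s≤s)) d+1≢k

rotateTail : List ℕ → List ℕ
rotateTail []      = []
rotateTail (_ ∷ t) = rotate 1 t

offDiagonal : ℕ → ℕ → List (List ℕ)
offDiagonal k a = filter (¬? ∘ Diagonal?) (partitions a (suc k) a)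

shiftedDiagonal : ℕ → ℕ → List (List ℕ)
shiftedDiagonal k a = concatMap (λ j → filter Diagonal? (partitions (a ∸ k) (suc j) (a ∸ k))) (upTo k)

rotateTail-offDiagonal : ∀ {k a x} → Partition (suc k) a x → ¬ Diagonal x → rotateTail x ∈ shiftedDiagonal k a
rotateTail-offDiagonal {zero}   (cons _ _) off = ⊥-elim (off here)
rotateTail-offDiagonal {suc k} {x = _ ∷ t} (cons {a = a′} j≤ π) off with rotate-Partition 0 π (off ∘ there)
... | zero    , π′ , _    with rotate 1 t | rotate-OnDiagonal 1 t
...   | []    | ()
...   | _ ∷ _ | _ with π′
...     | ()
rotateTail-offDiagonal {suc k} {x = _ ∷ t} (cons {a = a′} j≤ π) off | suc j′ , π′ , j′≤ =
  ∈-concatMap⁺′ {f = λ j → filter Diagonal? (partitions b (suc j) b)} (∈-upTo⁺ j′<k+1)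
    (∈-filter⁺ Diagonal? (partitions-complete b (Partition-resize size π′) ℕP.≤-refl) (rotate-OnDiagonal 1 t))
  where
  b = (suc (suc k) +ₙ a′) ∸ suc k
  size : a′ +ₙ 1 ≡ b
  size = trans (ℕP.+-comm a′ 1) (sym (trans (cong (_∸ k) (sym (ℕP.+-suc k a′))) (ℕP.m+n∸m≡n k (suc a′))))
  j′<k+1 : j′ < suc k
  j′<k+1 = ℕP.≤-trans j′≤ (ℕP.⊔-lub (s≤s z≤n) (ℕP.∸-monoˡ-≤ 1 j≤))

shiftedDiagonal⊆rotateTail : ∀ {k a z} → z ∈ shiftedDiagonal k a → z ∈ map rotateTail (offDiagonal k a)
shiftedDiagonal⊆rotateTail {zero} ()
shiftedDiagonal⊆rotateTail {suc k} {a} {z} z∈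
  with ∈-concatMap⁻′ (λ j → filter Diagonal? (partitions (a ∸ suc k) (suc j) (a ∸ suc k))) (upTo (suc k)) z∈
... | j , j∈ , z∈′ with ∈-filter⁻ Diagonal? z∈′
... | z∈p , on with partitions-sound (a ∸ suc k) (suc j) (a ∸ suc k) z∈p
... | π with unrotate-Partition 1 π on
... | (j₂ , π₂ , j₂≤) , off , 1≤b =
  subst (_∈ map rotateTail (offDiagonal (suc k) a)) (rotate-unrotate 1 π on)
    (∈-map⁺ rotateTail (∈-filter⁺ (¬? ∘ Diagonal?) (partitions-complete a πx ℕP.≤-refl) offx))
  where
  b = a ∸ suc k
  k<a : suc k < a
  k<a = ℕP.m∸n≢0⇒n<m (λ b≡0 → ℕP.<-irrefl (sym b≡0) 1≤b)
  size : suc (suc k) +ₙ (b ∸ 1) ≡ a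
  size = trans (sym (ℕP.+-suc (suc k) (b ∸ 1))) (trans (cong (suc k +ₙ_) (ℕP.m+[n∸m]≡n 1≤b)) (ℕP.m+[n∸m]≡n (ℕP.<⇒≤ k<a)))
  πx : Partition (suc (suc k)) a (suc (suc k) ∷ unrotate 1 z)
  πx = Partition-resize size (cons (ℕP.≤-trans j₂≤ (s≤s (∈-upTo⁻ j∈))) π₂)
  offx : ¬ Diagonal (suc (suc k) ∷ unrotate 1 z)
  offx (there on′) = off on′

rotateTail-injective : ∀ {k a x y} → Partition (suc k) a x → Partition (suc k) a y → rotateTail x ≡ rotateTail y → x ≡ y
rotateTail-injective {x = []}    ()
rotateTail-injective {y = []}    _ ()
rotateTail-injective {x = _ ∷ t} {y = _ ∷ t′} π π′ eq =
  cong₂ _∷_ (trans (Partition-largestPart π) (sym (Partition-largestPart π′)))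
            (trans (sym (unrotate-rotate 1 t)) (trans (cong (unrotate 1) eq) (unrotate-rotate 1 t′)))

length-offDiagonal : ∀ k a → length (offDiagonal k a) ≡ length (shiftedDiagonal k a)
length-offDiagonal k a = trans (sym (ListP.length-map rotateTail (offDiagonal k a)))
  (unique-length rotated! shifted! (mk⇔ to (shiftedDiagonal⊆rotateTail {k} {a})))
  where
  sound : ∀ {x} → x ∈ offDiagonal k a → Partition (suc k) a x × ¬ Diagonal x
  sound x∈ = let (x∈p , off) = ∈-filter⁻ (¬? ∘ Diagonal?) x∈ in partitions-sound a (suc k) a x∈p , off
  rotated! : Unique (map rotateTail (offDiagonal k a))
  rotated! = map-unique-on rotateTail (offDiagonal k a)
    (Unique.filter⁺ (¬? ∘ Diagonal?) (partitions-unique a (suc k) a))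
    (λ x y x∈ y∈ → rotateTail-injective (proj₁ (sound x∈)) (proj₁ (sound y∈)))
  shifted! : Unique (shiftedDiagonal k a)
  shifted! = concatMap-unique (λ j → filter Diagonal? (partitions (a ∸ k) (suc j) (a ∸ k))) (upTo k) (Unique.upTo⁺ k)
    (λ j _ → Unique.filter⁺ Diagonal? (partitions-unique (a ∸ k) (suc j) (a ∸ k)))
    (λ j j′ z _ _ z∈ z∈′ → ℕP.suc-injective (Partition-largest-unique
      (partitions-sound (a ∸ k) (suc j) _ (proj₁ (∈-filter⁻ Diagonal? z∈)))
      (partitions-sound (a ∸ k) (suc j′) _ (proj₁ (∈-filter⁻ Diagonal? z∈′)))))
  to : ∀ {z} → z ∈ map rotateTail (offDiagonal k a) → z ∈ shiftedDiagonal k a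
  to z∈ with ∈-map⁻ rotateTail z∈
  ... | x , x∈ , refl = rotateTail-offDiagonal (proj₁ (sound x∈)) (proj₂ (sound x∈))

-- The number of elements of F_q of width d and area a (see #enumFq≡F).
F : BiSeries
F zero    a = δ 0 a
F (suc d) a = # filter Diagonal? (partitions a (suc d) a)

F-triangular : Triangular F
F-triangular (suc d) a a<d = cong pos (cong length (ListP.filter-none Diagonal? (All.tabulate (λ ms∈ →
  ⊥-elim (ℕP.<⇒≱ a<d (Partition-largest≤size (partitions-sound a (suc d) a ms∈)))))))

P≡F+∑F : ∀ k a → P (suc k) a ≡ F (suc k) a + ∑[ j < k ] F (suc j) (a ∸ k)
P≡F+∑F k a = begin
  P (suc k) a
    ≡⟨ cong pos (sym (length-filter-split Diagonal? ps)) ⟩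
  pos (length (filter Diagonal? ps) +ₙ length (offDiagonal k a))
    ≡⟨ ℤP.pos-+ (length (filter Diagonal? ps)) (length (offDiagonal k a)) ⟩
  F (suc k) a + # offDiagonal k a
    ≡⟨ cong (λ n → F (suc k) a + pos n) (length-offDiagonal k a) ⟩
  F (suc k) a + # shiftedDiagonal k a
    ≡⟨ cong (F (suc k) a +_) (#-concatMap-upTo k (λ j → filter Diagonal? (partitions (a ∸ k) (suc j) (a ∸ k)))) ⟩
  F (suc k) a + ∑[ j < k ] F (suc j) (a ∸ k)  ∎
  where
  ps = partitions a (suc k) a

F-X : BiSeries
F-X d a = F d a - X d a

F-X-recurrence : ThetaRecurrence F-X
F-X-recurrence = recurrence , vanishing
  where
  vanishing : ∀ d a → suc a < d → F-X d a ≡ 0ℤ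
  vanishing (suc zero)    a (s≤s ())
  vanishing (suc (suc d)) a a+1<d = cong (_- X (suc (suc d)) a) (F-triangular (suc (suc d)) a (ℕP.<-trans (ℕP.n<1+n a) a+1<d))
  P0≡F0 : ∀ a → P 0 a ≡ F 0 a
  P0≡F0 zero    = refl
  P0≡F0 (suc a) = refl
  X-suc : ∀ k a → X (suc k) a ≡ F 0 (a ∸ k) - δ≤ 1 k * δ 0 (a ∸ k)
  X-suc zero    zero    = refl
  X-suc zero    (suc a) = refl
  X-suc (suc k) a       = lemma (a ∸ suc k)
    where
    lemma : ∀ b → 0ℤ ≡ F 0 b - 1ℤ * δ 0 b
    lemma zero    = refl
    lemma (suc b) = refl
  regroup : ∀ A S B C → A - (B - C) ≡ (A + S) - ((B - 0ℤ) + (S - C))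
  regroup = solve-∀
  recurrence : ∀ d a → d ≤ suc a → F-X d a ≡ P d a - ∑[ j < d ] F-X j (suc a ∸ d)
  recurrence zero    a _         = cong (_- X 0 a) (sym (P0≡F0 a))
  recurrence (suc k) a (s≤s k≤a) = begin
    F (suc k) a - X (suc k) a
      ≡⟨ cong (λ z → F (suc k) a - z) (X-suc k a) ⟩
    F (suc k) a - (F 0 b - δ≤ 1 k * δ 0 b)
      ≡⟨ regroup (F (suc k) a) (∑[ j < k ] F (suc j) b) (F 0 b) (δ≤ 1 k * δ 0 b) ⟩
    (F (suc k) a + ∑[ j < k ] F (suc j) b) - ((F 0 b - 0ℤ) + (∑[ j < k ] F (suc j) b - δ≤ 1 k * δ 0 b))
      ≡⟨ cong₂ _-_ (sym (P≡F+∑F k a)) (cong ((F 0 b - 0ℤ) +_) (sym ∑-tail)) ⟩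
    P (suc k) a - ∑[ j < suc k ] F-X j b  ∎
    where
    b = a ∸ k
    ∑-tail : ∑[ j < k ] F-X (suc j) b ≡ ∑[ j < k ] F (suc j) b - δ≤ 1 k * δ 0 b
    ∑-tail = begin
      ∑[ j < k ] (F (suc j) b + - (δ 1 (suc j) * δ 0 b))
        ≡⟨ ∑-distrib-+ k (λ j → F (suc j) b) (λ j → - (δ 1 (suc j) * δ 0 b)) ⟩
      ∑[ j < k ] F (suc j) b + ∑[ j < k ] (- (δ 0 j * δ 0 b))
        ≡⟨ cong (∑[ j < k ] F (suc j) b +_) (trans (∑-neg k (λ j → δ 0 j * δ 0 b)) (cong -_ (∑-δ≤ k 0 (δ 0 b)))) ⟩
      ∑[ j < k ] F (suc j) b - δ≤ 1 k * δ 0 b  ∎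

-- Enumerating F_q

Partition⇒IsFerrers : ∀ {d a ms} → Partition d a ms → IsFerrers ms
Partition⇒IsFerrers nil          = [] , []
Partition⇒IsFerrers (cons j≤ π) = linked j≤ π , s≤s z≤n ∷ proj₂ (Partition⇒IsFerrers π)
  where
  linked : ∀ {d j a ms} → j ≤ suc d → Partition j a ms → Linked _≥_ (suc d ∷ ms)
  linked _  nil           = [-]
  linked j≤ (cons j′≤ π′) = j≤ ∷ proj₁ (Partition⇒IsFerrers (cons j′≤ π′))

IsFerrers⇒Partition : ∀ ms → IsFerrers ms → Partition (largestPart ms) (sum ms) ms
IsFerrers⇒Partition []             _                     = nil
IsFerrers⇒Partition (suc d ∷ rest) (dec , s≤s z≤n ∷ rest≥1) =
  cons (head≤ rest dec) (IsFerrers⇒Partition rest (Linked.tail dec , rest≥1))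
  where
  head≤ : ∀ rest → Linked _≥_ (suc d ∷ rest) → largestPart rest ≤ suc d
  head≤ []      _         = z≤n
  head≤ (_ ∷ _) (m≤ ∷ _) = m≤

IsFerrers-irrelevant : ∀ {ms} (p q : IsFerrers ms) → p ≡ q
IsFerrers-irrelevant (dec , ≥1) (dec′ , ≥1′) =
  cong₂ _,_ (Linked.irrelevant ℕP.≤-irrelevant dec dec′) (All.irrelevant ℕP.≤-irrelevant ≥1 ≥1′)

lookup-decreasing : ∀ {ms} → Linked _≥_ ms → (i j : Fin (length ms)) → toℕ i ≤ toℕ j → lookup ms j ≤ lookup ms i
lookup-decreasing {_ ∷ _}     dec      Fin.zero    Fin.zero    _         = ℕP.≤-refl
lookup-decreasing {_ ∷ _ ∷ _} (m≤ ∷ dec) Fin.zero  (Fin.suc j) _         = ℕP.≤-trans (lookup-decreasing dec Fin.zero j z≤n) m≤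
lookup-decreasing {_ ∷ _}     dec      (Fin.suc i) (Fin.suc j) (s≤s i≤j) = lookup-decreasing (Linked.tail dec) i j i≤j

-- In a weakly decreasing list, the rows minus their indices strictly decrease, so the diagonal cell is unique.
HasDiagonal-irrelevant : ∀ {ms} → Linked _≥_ ms → (p q : HasDiagonal ms) → p ≡ q
HasDiagonal-irrelevant {ms} dec (i , eq) (i′ , eq′) with FinP.toℕ-injective {i = i} {j = i′} same-index
  where
  same-index : toℕ i ≡ toℕ i′
  same-index with ℕP.<-cmp (toℕ i) (toℕ i′)
  ... | tri≈ _ i≡i′ _ = i≡i′
  ... | tri< i<i′ _ _ = ⊥-elim (ℕP.<-irrefl refl
                          (ℕP.<-≤-trans (s≤s i<i′) (subst₂ _≤_ eq′ eq (lookup-decreasing dec i i′ (ℕP.<⇒≤ i<i′)))))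
  ... | tri> _ _ i′<i = ⊥-elim (ℕP.<-irrefl refl
                          (ℕP.<-≤-trans (s≤s i′<i) (subst₂ _≤_ eq eq′ (lookup-decreasing dec i′ i (ℕP.<⇒≤ i′<i)))))
... | refl = cong (i ,_) (ℕP.≡-irrelevant eq eq′)

fqRows : ∀ {d} → Fq d → List ℕ
fqRows (inj₁ _)            = []
fqRows (inj₂ ((ms , _) , _)) = ms

fqArea≡sum : ∀ {d} (f : Fq d) → fqArea f ≡ sum (fqRows f)
fqArea≡sum (inj₁ _) = refl
fqArea≡sum (inj₂ _) = refl

width≡largestPart : ∀ ms pf → width (ms , pf) ≡ largestPart ms
width≡largestPart []      _ = refl
width≡largestPart (_ ∷ _) _ = refl

fqRows-injective : ∀ {d} (f g : Fq (suc d)) → fqRows f ≡ fqRows g → f ≡ g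
fqRows-injective (inj₂ ((ms , fer , diag) , w)) (inj₂ ((.ms , fer′ , diag′) , w′)) refl
  with IsFerrers-irrelevant fer fer′ | HasDiagonal-irrelevant (proj₁ fer) diag diag′
... | refl | refl = cong (λ w → inj₂ ((ms , fer , diag) , w)) (ℕP.≡-irrelevant w w′)

Fq-width≤area : ∀ {d} (f : Fq d) → d ≤ fqArea f
Fq-width≤area (inj₁ refl)                   = z≤n
Fq-width≤area (inj₂ ((ms , pf@(fer , _)) , refl)) =
  subst (_≤ sum ms) (sym (width≡largestPart ms pf)) (Partition-largest≤size (IsFerrers⇒Partition ms fer))

diagonalPartitions : ℕ → ℕ → List (List ℕ)
diagonalPartitions d a = filter Diagonal? (partitions a (suc d) a)

toFq : ∀ d a {ms} → ms ∈ diagonalPartitions d a → Fq (suc d)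
toFq d a {ms} ms∈ = inj₂ ((ms , pf) , trans (width≡largestPart ms pf) (Partition-largestPart π))
  where
  filtered = ∈-filter⁻ Diagonal? {xs = partitions a (suc d) a} ms∈
  π = partitions-sound a (suc d) a (proj₁ filtered)
  pf : IsFerrers ms × HasDiagonal ms
  pf = Partition⇒IsFerrers π , Equivalence.from (HasDiagonal⇔Diagonal ms) (proj₂ filtered)

enumFq : (d a : ℕ) → List (Fq d)
enumFq zero    zero    = inj₁ refl ∷ []
enumFq zero    (suc a) = []
enumFq (suc d) a       = mapWith∈ (diagonalPartitions d a) (toFq d a)

map-fqRows-enumFq : ∀ d a → map fqRows (enumFq (suc d) a) ≡ diagonalPartitions d a
map-fqRows-enumFq d a = trans (map-mapWith∈ (diagonalPartitions d a) (toFq d a) fqRows) (mapWith∈-id (diagonalPartitions d a))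

#enumFq≡F : ∀ d a → # enumFq d a ≡ F d a
#enumFq≡F zero    zero    = refl
#enumFq≡F zero    (suc a) = refl
#enumFq≡F (suc d) a       = cong pos (trans (sym (ListP.length-map fqRows (enumFq (suc d) a))) (cong length (map-fqRows-enumFq d a)))

enumFq-unique : ∀ d a → Unique (enumFq d a)
enumFq-unique zero    zero    = [] ∷ []
enumFq-unique zero    (suc a) = []
enumFq-unique (suc d) a       = Unique.map⁻ (subst Unique (sym (map-fqRows-enumFq d a))
                                  (Unique.filter⁺ Diagonal? (partitions-unique a (suc d) a)))

enumFq-sound : ∀ d a {f} → f ∈ enumFq d a → fqArea f ≡ a
enumFq-sound zero    zero    (here refl) = refl
enumFq-sound (suc d) a       {f} f∈ =
  trans (fqArea≡sum f) (Partition-sum (partitions-sound a (suc d) a (proj₁ (∈-filter⁻ Diagonal? rows∈))))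
  where
  rows∈ : fqRows f ∈ diagonalPartitions d a
  rows∈ = subst (fqRows f ∈_) (map-fqRows-enumFq d a) (∈-map⁺ fqRows f∈)

enumFq-complete : ∀ d a (f : Fq d) → fqArea f ≡ a → f ∈ enumFq d a
enumFq-complete zero    a (inj₁ refl)                           refl = here refl
enumFq-complete zero    a (inj₂ ((m ∷ _ , (_ , 1≤m ∷ _) , _) , w)) _ = ⊥-elim (ℕP.<-irrefl (sym w) 1≤m)
enumFq-complete (suc d) a (inj₂ ((ms , fer , diag) , w)) refl with ∈-map⁻ fqRows rows∈
  where
  π : Partition (suc d) (sum ms) ms
  π = subst (λ e → Partition e (sum ms) ms) (trans (sym (width≡largestPart ms (fer , diag))) w) (IsFerrers⇒Partition ms fer)
  rows∈ : ms ∈ map fqRows (enumFq (suc d) (sum ms))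
  rows∈ = subst (ms ∈_) (sym (map-fqRows-enumFq d (sum ms)))
            (∈-filter⁺ Diagonal? (partitions-complete (sum ms) π ℕP.≤-refl) (Equivalence.to (HasDiagonal⇔Diagonal ms) diag))
... | g , g∈ , ms≡ = subst (_∈ enumFq (suc d) (sum ms)) (fqRows-injective g _ (sym ms≡)) g∈

-- Enumerating F_q-enriched trees

mutual
  height : Tree → ℕ
  height (node ts _) = suc (maxHeight ts)

  maxHeight : List Tree → ℕ
  maxHeight []       = 0
  maxHeight (t ∷ ts) = height t ⊔ maxHeight ts

mutual
  -- The trees of area m and height at most fuel.
  trees : ℕ → ℕ → List Tree
  trees zero       m = []
  trees (suc fuel) m = concatMap (λ d → concatMap (λ a → rootedAt fuel d a (m ∸ a)) (upTo (suc m))) (upTo (suc m))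

  rootedAt : ℕ → ℕ → ℕ → ℕ → List Tree
  rootedAt fuel d a k = concatMap (λ ts → map (node ts) (enumFq (length ts) a)) (forests fuel d k)

  forests : ℕ → ℕ → ℕ → List (List Tree)
  forests fuel zero    zero    = [] ∷ []
  forests fuel zero    (suc k) = []
  forests fuel (suc n) k       =
    concatMap (λ k₁ → concatMap (λ t → map (t ∷_) (forests fuel n (k ∸ k₁))) (trees fuel k₁)) (upTo (suc k))

mutual
  height≤1+area : ∀ t → height t ≤ suc (treeArea t)
  height≤1+area (node []       f) = s≤s z≤n
  height≤1+area (node (t ∷ ts) f) = s≤s (ℕP.≤-trans (maxHeight≤1+area (t ∷ ts))
    (ℕP.≤-trans (s≤s (ℕP.m≤n+m (forestArea (t ∷ ts)) (length ts))) (ℕP.+-monoˡ-≤ (forestArea (t ∷ ts)) (Fq-width≤area f))))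

  maxHeight≤1+area : ∀ ts → maxHeight ts ≤ suc (forestArea ts)
  maxHeight≤1+area []       = z≤n
  maxHeight≤1+area (t ∷ ts) = ℕP.⊔-lub (ℕP.≤-trans (height≤1+area t) (s≤s (ℕP.m≤m+n _ _)))
                                        (ℕP.≤-trans (maxHeight≤1+area ts) (s≤s (ℕP.m≤n+m _ _)))

mutual
  trees-sound : ∀ fuel m {t} → t ∈ trees fuel m → treeArea t ≡ m × height t ≤ fuel
  trees-sound (suc fuel) m t∈
    with ∈-concatMap⁻′ (λ d → concatMap (λ a → rootedAt fuel d a (m ∸ a)) (upTo (suc m))) (upTo (suc m)) t∈
  ... | d , _ , t∈₁ with ∈-concatMap⁻′ (λ a → rootedAt fuel d a (m ∸ a)) (upTo (suc m)) t∈₁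
  ... | a , a∈ , t∈₂ with ∈-concatMap⁻′ (λ ts → map (node ts) (enumFq (length ts) a)) (forests fuel d (m ∸ a)) t∈₂
  ... | ts , ts∈ , t∈₃ with ∈-map⁻ (node ts) t∈₃
  ... | f , f∈ , refl with forests-sound fuel d (m ∸ a) ts∈
  ... | _ , area , h =
    trans (cong₂ _+ₙ_ (enumFq-sound (length ts) a f∈) area) (ℕP.m+[n∸m]≡n (ℕP.≤-pred (∈-upTo⁻ a∈))) , s≤s h

  forests-sound : ∀ fuel n k {ts} → ts ∈ forests fuel n k → length ts ≡ n × forestArea ts ≡ k × maxHeight ts ≤ fuel
  forests-sound fuel zero    zero    (here refl) = refl , refl , z≤n
  forests-sound fuel (suc n) k ts∈
    with ∈-concatMap⁻′ (λ k₁ → concatMap (λ t → map (t ∷_) (forests fuel n (k ∸ k₁))) (trees fuel k₁)) (upTo (suc k)) ts∈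
  ... | k₁ , k₁∈ , ts∈₁ with ∈-concatMap⁻′ (λ t → map (t ∷_) (forests fuel n (k ∸ k₁))) (trees fuel k₁) ts∈₁
  ... | t , t∈ , ts∈₂ with ∈-map⁻ (t ∷_) ts∈₂
  ... | ts′ , ts′∈ , refl with trees-sound fuel k₁ t∈ | forests-sound fuel n (k ∸ k₁) ts′∈
  ... | area , h | len , area′ , h′ =
    cong suc len , trans (cong₂ _+ₙ_ area area′) (ℕP.m+[n∸m]≡n (ℕP.≤-pred (∈-upTo⁻ k₁∈))) , ℕP.⊔-lub h h′

mutual
  trees-complete : ∀ fuel m t → treeArea t ≡ m → height t ≤ fuel → t ∈ trees fuel m
  trees-complete (suc fuel) m (node ts f) area (s≤s h) =
    ∈-concatMap⁺′ {f = λ d → concatMap (λ a → rootedAt fuel d a (m ∸ a)) (upTo (suc m))} (∈-upTo⁺ (s≤s d≤m))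
      (∈-concatMap⁺′ {f = λ a → rootedAt fuel (length ts) a (m ∸ a)} (∈-upTo⁺ (s≤s a≤m))
        (∈-concatMap⁺′ {f = λ ts′ → map (node ts′) (enumFq (length ts′) (fqArea f))}
          (forests-complete fuel (length ts) (m ∸ fqArea f) ts refl rest h)
          (∈-map⁺ (node ts) (enumFq-complete (length ts) (fqArea f) f refl))))
    where
    a≤m : fqArea f ≤ m
    a≤m = subst (fqArea f ≤_) area (ℕP.m≤m+n (fqArea f) (forestArea ts))
    d≤m : length ts ≤ m
    d≤m = ℕP.≤-trans (Fq-width≤area f) a≤m
    rest : forestArea ts ≡ m ∸ fqArea f
    rest = sym (trans (cong (_∸ fqArea f) (sym area)) (ℕP.m+n∸m≡n (fqArea f) (forestArea ts)))

  forests-complete : ∀ fuel n k ts → length ts ≡ n → forestArea ts ≡ k → maxHeight ts ≤ fuel → ts ∈ forests fuel n k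
  forests-complete fuel zero    zero []       refl refl _ = here refl
  forests-complete fuel (suc n) k    (t ∷ ts) refl area h =
    ∈-concatMap⁺′ {f = λ k₁ → concatMap (λ t → map (t ∷_) (forests fuel n (k ∸ k₁))) (trees fuel k₁)}
      (∈-upTo⁺ (s≤s k₁≤k))
      (∈-concatMap⁺′ {f = λ t′ → map (t′ ∷_) (forests fuel n (k ∸ treeArea t))}
        (trees-complete fuel (treeArea t) t refl (ℕP.≤-trans (ℕP.m≤m⊔n _ _) h))
        (∈-map⁺ (t ∷_) (forests-complete fuel n (k ∸ treeArea t) ts refl rest (ℕP.≤-trans (ℕP.m≤n⊔m _ _) h))))
    where
    k₁≤k : treeArea t ≤ k
    k₁≤k = subst (treeArea t ≤_) area (ℕP.m≤m+n _ _)
    rest : forestArea ts ≡ k ∸ treeArea t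
    rest = sym (trans (cong (_∸ treeArea t) (sym area)) (ℕP.m+n∸m≡n (treeArea t) (forestArea ts)))

children : Tree → List Tree
children (node ts _) = ts

rootArea : Tree → ℕ
rootArea (node _ f) = fqArea f

node-injectiveʳ : ∀ {ts} {f f′ : Fq (length ts)} → node ts f ≡ node ts f′ → f ≡ f′
node-injectiveʳ refl = refl

rootedAt-children : ∀ fuel d a k {t} → t ∈ rootedAt fuel d a k → children t ∈ forests fuel d k × rootArea t ≡ a
rootedAt-children fuel d a k t∈ with ∈-concatMap⁻′ (λ ts → map (node ts) (enumFq (length ts) a)) (forests fuel d k) t∈
... | ts , ts∈ , t∈′ with ∈-map⁻ (node ts) t∈′
... | f , f∈ , refl = ts∈ , enumFq-sound (length ts) a f∈

mutual
  trees-unique : ∀ fuel m → Unique (trees fuel m)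
  trees-unique zero       m = []
  trees-unique (suc fuel) m =
    concatMap-unique (λ d → concatMap (λ a → rootedAt fuel d a (m ∸ a)) (upTo (suc m))) (upTo (suc m)) (Unique.upTo⁺ _)
      (λ d _ → concatMap-unique (λ a → rootedAt fuel d a (m ∸ a)) (upTo (suc m)) (Unique.upTo⁺ _)
        (λ a _ → rootedAt-unique fuel d a (m ∸ a))
        (λ a a′ t _ _ t∈ t∈′ → trans (sym (proj₂ (rootedAt-children fuel d a (m ∸ a) t∈)))
                                     (proj₂ (rootedAt-children fuel d a′ (m ∸ a′) t∈′))))
      (λ d d′ t _ _ t∈ t∈′ → trans (sym (degree d t∈)) (degree d′ t∈′))
    where
    degree : ∀ d {t} → t ∈ concatMap (λ a → rootedAt fuel d a (m ∸ a)) (upTo (suc m)) → length (children t) ≡ d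
    degree d t∈ with ∈-concatMap⁻′ (λ a → rootedAt fuel d a (m ∸ a)) (upTo (suc m)) t∈
    ... | a , _ , t∈′ = proj₁ (forests-sound fuel d (m ∸ a) (proj₁ (rootedAt-children fuel d a (m ∸ a) t∈′)))

  rootedAt-unique : ∀ fuel d a k → Unique (rootedAt fuel d a k)
  rootedAt-unique fuel d a k =
    concatMap-unique (λ ts → map (node ts) (enumFq (length ts) a)) (forests fuel d k) (forests-unique fuel d k)
      (λ ts _ → Unique.map⁺ node-injectiveʳ (enumFq-unique (length ts) a))
      (λ ts ts′ t _ _ t∈ t∈′ → trans (sym (children-map t∈)) (children-map t∈′))
    where
    children-map : ∀ {ts t} → t ∈ map (node ts) (enumFq (length ts) a) → children t ≡ ts
    children-map {ts} t∈ with ∈-map⁻ (node ts) t∈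
    ... | _ , _ , refl = refl

  forests-unique : ∀ fuel n k → Unique (forests fuel n k)
  forests-unique fuel zero    zero    = [] ∷ []
  forests-unique fuel zero    (suc k) = []
  forests-unique fuel (suc n) k =
    concatMap-unique (λ k₁ → concatMap (λ t → map (t ∷_) (forests fuel n (k ∸ k₁))) (trees fuel k₁)) (upTo (suc k)) (Unique.upTo⁺ _)
      (λ k₁ _ → concatMap-unique (λ t → map (t ∷_) (forests fuel n (k ∸ k₁))) (trees fuel k₁) (trees-unique fuel k₁)
        (λ t _ → Unique.map⁺ ListP.∷-injectiveʳ (forests-unique fuel n (k ∸ k₁)))
        (λ t t′ ts _ _ ts∈ ts∈′ → just-injective (trans (sym (head-map ts∈)) (head-map ts∈′))))
      (λ k₁ k₁′ ts _ _ ts∈ ts∈′ → same-area (head-in ts∈) (head-in ts∈′))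
    where
    head-map : ∀ {t ts k′} → ts ∈ map (t ∷_) (forests fuel n k′) → head ts ≡ just t
    head-map {t} ts∈ with ∈-map⁻ (t ∷_) ts∈
    ... | _ , _ , refl = refl
    head-in : ∀ {k₁ k′ ts} → ts ∈ concatMap (λ t → map (t ∷_) (forests fuel n k′)) (trees fuel k₁) →
              Σ Tree (λ t → head ts ≡ just t × treeArea t ≡ k₁)
    head-in {k₁} {k′} ts∈ with ∈-concatMap⁻′ (λ t → map (t ∷_) (forests fuel n k′)) (trees fuel k₁) ts∈
    ... | t , t∈ , ts∈′ = t , head-map ts∈′ , proj₁ (trees-sound fuel k₁ t∈)
    same-area : ∀ {ts k₁ k₁′} → Σ Tree (λ t → head ts ≡ just t × treeArea t ≡ k₁) →
                Σ Tree (λ t → head ts ≡ just t × treeArea t ≡ k₁′) → k₁ ≡ k₁′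
    same-area (t , h , a) (t′ , h′ , a′) = trans (sym a) (trans (cong treeArea (just-injective (trans (sym h) h′))) a′)

-- The tree series and its functional equation

treeCount : ℕ → FPS
treeCount fuel m = # trees fuel m

#-concatMap-const : ∀ {A B : Set} (f : A → List B) xs c → (∀ x → x ∈ xs → length (f x) ≡ c) →
                    # concatMap f xs ≡ # xs * pos c
#-concatMap-const f xs c len≡c = trans (cong pos (length-concatMap-const f xs c len≡c)) (ℤP.pos-* (length xs) c)

#forests : ∀ fuel n k → # forests fuel n k ≡ (treeCount fuel ^ₛ n) k
#forests fuel zero    zero    = refl
#forests fuel zero    (suc k) = refl
#forests fuel (suc n) k = begin
  # concatMap (λ k₁ → concatMap (λ t → map (t ∷_) (forests fuel n (k ∸ k₁))) (trees fuel k₁)) (upTo (suc k))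
    ≡⟨ #-concatMap-upTo (suc k) (λ k₁ → concatMap (λ t → map (t ∷_) (forests fuel n (k ∸ k₁))) (trees fuel k₁)) ⟩
  ∑[ k₁ < suc k ] # concatMap (λ t → map (t ∷_) (forests fuel n (k ∸ k₁))) (trees fuel k₁)
    ≡⟨ ∑-cong (suc k) (λ k₁ → trans (#-concatMap-const (λ t → map (t ∷_) (forests fuel n (k ∸ k₁))) (trees fuel k₁) _
                                       (λ t _ → ListP.length-map (t ∷_) (forests fuel n (k ∸ k₁))))
                                     (cong (treeCount fuel k₁ *_) (#forests fuel n (k ∸ k₁)))) ⟩
  ∑[ k₁ < suc k ] (treeCount fuel k₁ * (treeCount fuel ^ₛ n) (k ∸ k₁))
    ≡⟨ sym (*ₛ-as-∑ (treeCount fuel) (treeCount fuel ^ₛ n) k) ⟩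
  (treeCount fuel ^ₛ suc n) k  ∎

-- A tree is a root decoration together with a forest, one tree per child.
treeCount-suc : ∀ fuel m → treeCount (suc fuel) m ≡ substitute F (treeCount fuel) m
treeCount-suc fuel m = begin
  # concatMap (λ d → concatMap (λ a → rootedAt fuel d a (m ∸ a)) (upTo (suc m))) (upTo (suc m))
    ≡⟨ #-concatMap-upTo (suc m) (λ d → concatMap (λ a → rootedAt fuel d a (m ∸ a)) (upTo (suc m))) ⟩
  ∑[ d < suc m ] # concatMap (λ a → rootedAt fuel d a (m ∸ a)) (upTo (suc m))
    ≡⟨ ∑-cong (suc m) (λ d → #-concatMap-upTo (suc m) (λ a → rootedAt fuel d a (m ∸ a))) ⟩
  ∑[ d < suc m ] ∑[ a < suc m ] # rootedAt fuel d a (m ∸ a)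
    ≡⟨ ∑-cong (suc m) (λ d → ∑-cong (suc m) (λ a → #rootedAt d a (m ∸ a))) ⟩
  substitute F (treeCount fuel) m  ∎
  where
  #rootedAt : ∀ d a k → # rootedAt fuel d a k ≡ F d a * (treeCount fuel ^ₛ d) k
  #rootedAt d a k = begin
    # rootedAt fuel d a k
      ≡⟨ #-concatMap-const (λ ts → map (node ts) (enumFq (length ts) a)) (forests fuel d k) (length (enumFq d a))
           (λ ts ts∈ → trans (ListP.length-map (node ts) (enumFq (length ts) a))
                             (cong (λ l → length (enumFq l a)) (proj₁ (forests-sound fuel d k ts∈)))) ⟩
    # forests fuel d k * # enumFq d a
      ≡⟨ cong₂ _*_ (#forests fuel d k) (#enumFq≡F d a) ⟩
    (treeCount fuel ^ₛ d) k * F d a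
      ≡⟨ ℤP.*-comm _ (F d a) ⟩
    F d a * (treeCount fuel ^ₛ d) k  ∎

trees-∈⇔ : ∀ fuel m → m < fuel → ∀ {t} → t ∈ trees fuel m ⇔ treeArea t ≡ m
trees-∈⇔ fuel m m<fuel {t} = mk⇔ (λ t∈ → proj₁ (trees-sound fuel m t∈))
  (λ area → trees-complete fuel m t area (ℕP.≤-trans (height≤1+area t) (subst (λ z → suc z ≤ fuel) (sym area) m<fuel)))

treeCount-fuel-irrelevant : ∀ fuel fuel′ m → m < fuel → m < fuel′ → treeCount fuel m ≡ treeCount fuel′ m
treeCount-fuel-irrelevant fuel fuel′ m m<fuel m<fuel′ =
  cong pos (unique-length (trees-unique fuel m) (trees-unique fuel′ m)
    (mk⇔ (Equivalence.from (trees-∈⇔ fuel′ m m<fuel′) ∘ Equivalence.to (trees-∈⇔ fuel m m<fuel))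
         (Equivalence.from (trees-∈⇔ fuel m m<fuel) ∘ Equivalence.to (trees-∈⇔ fuel′ m m<fuel′))))

treeSeries : FPS
treeSeries m = treeCount (suc m) m

-- Since only the empty polyomino has area 0, the q^m coefficient of F(ξ, q) only involves ξ 0 … ξ (m − 1).
substitute-F-local : ∀ (ξ η : FPS) m → (∀ i → i < m → ξ i ≡ η i) → substitute F ξ m ≡ substitute F η m
substitute-F-local ξ η m ξ≡η = ∑-cong (suc m) (λ d → ∑-cong< (suc m) (λ a a≤m → term d a a≤m))
  where
  term : ∀ d a → a < suc m → F d a * (ξ ^ₛ d) (m ∸ a) ≡ F d a * (η ^ₛ d) (m ∸ a)
  term zero    zero    _ = refl
  term (suc d) zero    _ = trans (*-zeroˡ′ ((ξ ^ₛ suc d) m) (F-triangular (suc d) 0 (s≤s z≤n)))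
                                 (sym (*-zeroˡ′ ((η ^ₛ suc d) m) (F-triangular (suc d) 0 (s≤s z≤n))))
  term d       (suc a) (s≤s a<m) = cong (F d (suc a) *_) (^ₛ-cong≤ ξ η d (m ∸ suc a)
    (λ i i≤ → ξ≡η i (ℕP.≤-<-trans i≤ (ℕP.∸-monoʳ-< {m} {suc a} {0} (s≤s z≤n) a<m))))

treeSeries-equation : ∀ m → treeSeries m ≡ substitute F treeSeries m
treeSeries-equation m = trans (treeCount-suc m m)
  (substitute-F-local (treeCount m) treeSeries m (λ i i<m → treeCount-fuel-irrelevant m (suc i) i i<m (ℕP.n<1+n i)))

substitute-F-fixed-point-unique : ∀ (ξ η : FPS) → (∀ m → ξ m ≡ substitute F ξ m) → (∀ m → η m ≡ substitute F η m) →
                                  ∀ m → ξ m ≡ η m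
substitute-F-fixed-point-unique ξ η ξ-fix η-fix =
  <-rec (λ m → ξ m ≡ η m) (λ m ih → trans (ξ-fix m) (trans (substitute-F-local ξ η m (λ i → ih {i})) (sym (η-fix m))))

Θ₀P≡F-X : ∀ d a → Θ₀P d a ≡ F-X d a
Θ₀P≡F-X = ThetaRecurrence-unique Θ₀P-recurrence F-X-recurrence

Θ₀-P-identity : ∀ (ξ : FPS) m → (Theta0AtNeg ξ *ₛ substitute P ξ) m ≡ substitute F ξ m - ξ m
Θ₀-P-identity ξ m = begin
  (Theta0AtNeg ξ *ₛ substitute P ξ) m
    ≡⟨ sym (*ₛ-cong≤ m (λ i i≤m → Θ₀-box≡Theta0AtNeg N i ξ (i+1<N i≤m))
                       (λ i i≤m → substitute-box≡substitute N i P ξ P-triangular (ℕP.<-trans (ℕP.n<1+n i) (i+1<N i≤m)))) ⟩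
  (Θ₀-box N ξ *ₛ substitute-box N P ξ) m
    ≡⟨ sym (substitute-box-Θ₀-times N m ξ P P-triangular (ℕP.n<1+n _)) ⟩
  substitute-box N (Θ₀-times N P) ξ m
    ≡⟨ ∑-cong< N (λ d d<N → ∑-cong< N (λ a a<N → ∑-cong N (λ k →
         cong (λ c → δ (a +ₙ k) m * (c * (ξ ^ₛ d) k)) (trans (Θ₀-times-stable N P d a d<N a<N) (Θ₀P≡F-X d a))))) ⟩
  substitute-box N F-X ξ m
    ≡⟨ substitute-box-− N F X ξ m ⟩
  substitute-box N F ξ m - substitute-box N X ξ m
    ≡⟨ cong₂ _-_ (substitute-box≡substitute N m F ξ F-triangular (ℕP.<-trans (ℕP.n<1+n m) m+1<N)) (substitute-box-X N m ξ m+1<N) ⟩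
  substitute F ξ m - ξ m  ∎
  where
  N = suc (suc (m +ₙ m))
  i+1<N : ∀ {i} → i ≤ m → suc i < N
  i+1<N i≤m = s≤s (s≤s (ℕP.≤-trans i≤m (ℕP.m≤m+n m m)))
  m+1<N : suc m < N
  m+1<N = i+1<N ℕP.≤-refl

treeSeries-root : IsRootOfTheta0 treeSeries
treeSeries-root = *ₛ-unit-cancel (Theta0AtNeg treeSeries) (substitute P treeSeries) product≡0 refl
  where
  product≡0 : ∀ m → (Theta0AtNeg treeSeries *ₛ substitute P treeSeries) m ≡ 0ℤ
  product≡0 m = trans (Θ₀-P-identity treeSeries m)
    (trans (cong (_- treeSeries m) (sym (treeSeries-equation m))) (ℤP.+-inverseʳ (treeSeries m)))

root-fixed-point : ∀ (ξ : FPS) → IsRootOfTheta0 ξ → ∀ m → ξ m ≡ substitute F ξ m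
root-fixed-point ξ root m = sym (ℤP.i-j≡0⇒i≡j _ _ (trans (sym (Θ₀-P-identity ξ m)) (begin
  (Theta0AtNeg ξ *ₛ substitute P ξ) m
    ≡⟨ *ₛ-as-∑ (Theta0AtNeg ξ) (substitute P ξ) m ⟩
  ∑[ k < suc m ] (Theta0AtNeg ξ k * substitute P ξ (m ∸ k))
    ≡⟨ ∑-zero (suc m) (λ k _ → *-zeroˡ′ (substitute P ξ (m ∸ k)) (root k)) ⟩
  0ℤ  ∎)))

theorem2 : Σ (ℕ → ℕ) (λ c →
             ((A : ℕ) → HasTreeCount A (c A))
             × IsRootOfTheta0 (λ A → pos (c A))
             × ((ξ : FPS) → IsRootOfTheta0 ξ → (A : ℕ) → ξ A ≡ pos (c A)))
theorem2 =
    (λ A → length (trees (suc A) A))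
  , (λ A → trees (suc A) A , trees-unique (suc A) A , (λ t → trees-∈⇔ (suc A) A (ℕP.n<1+n A)) , refl)
  , treeSeries-root
  , (λ ξ root → substitute-F-fixed-point-unique ξ treeSeries (root-fixed-point ξ root) treeSeries-equation)
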